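{- Let $p$ be a prime with $p\equiv 15$ or $27\pmod{28}$. For all integers $m,n,k\geq 0$ with $p\nmid n$, \[ c_{9,5}\left(2^{3k+3}p^{2m+1}n+\frac{3\cdot 2^{3k+4}p^{2m+2}+1}{7}\right)\equiv 0\pmod 2. \]
   Context: For complex $a,b$ the false theta function is $\Psi(a,b):=\sum_{n=0}^\infty a^{n(n+1)/2}b^{n(n-1)/2}-\sum_{n=-\infty}^{ -1}a^{n(n+1)/2}b^{n(n-1)/2}$. For positive integers $r,s$, the integers $c_{r,s}(n)$ ($n\ge 0$) are defined by the power series identity $\sum_{n=0}^\infty c_{r,s}(n)q^n=\dfrac{1}{\Psi(-q^r,q^s)}$ (the denominator is a power series in $q$ with constant term $1$). -}

module Defs where

open import Data.Nat as ℕ using (ℕ; zero; suc)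
open import Data.Nat.DivMod using (_/_; _%_)
open import Data.Integer as ℤ using (ℤ; +_; -_)
open import Data.List using (List; []; _∷_; map; upTo; zipWith; foldr)
open import Data.Bool using (if_then_else_)

sum : List ℤ → ℤ
sum = foldr ℤ._+_ (+ 0)

tri : ℕ → ℕ
tri n = (n ℕ.* suc n) / 2

sgn : ℕ → ℤ
sgn t = if (t % 2) ℕ.≡ᵇ 0 then + 1 else - (+ 1)

δ : ℕ → ℕ → ℤ
δ a b = if a ℕ.≡ᵇ b then + 1 else + 0

-- Coefficient of q^N in Ψ(-q^r, q^s).
--  * term n ≥ 0 : (-1)^{n(n+1)/2} q^{r n(n+1)/2 + s n(n-1)/2}
--  * term n = -j, j ≥ 1 : -(-1)^{j(j-1)/2} q^{r j(j-1)/2 + s j(j+1)/2}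
-- Since r,s ≥ 1, each exponent is ≥ |n|, so indices up to N suffice.
psiCoeff : ℕ → ℕ → ℕ → ℤ
psiCoeff r s N =
  sum (map (λ n → sgn (tri n) ℤ.* δ (r ℕ.* tri n ℕ.+ s ℕ.* tri (n ℕ.∸ 1)) N) (upTo (suc N)))
  ℤ.- sum (map (λ j → sgn (tri (j ℕ.∸ 1)) ℤ.* δ (r ℕ.* tri (j ℕ.∸ 1) ℕ.+ s ℕ.* tri j) N)
               (map suc (upTo (suc N))))

-- [c(N), c(N-1), …, c(0)] for the reciprocal series 1/Ψ(-q^r,q^s):
-- c(0) = 1 (constant term of Ψ is 1), c(N) = - Σ_{i=1}^{N} ψ(i) c(N-i).
cList : ℕ → ℕ → ℕ → List ℤ
cList r s zero = + 1 ∷ []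
cList r s (suc N) =
  let prev = cList r s N in
  - sum (zipWith (λ i c → psiCoeff r s i ℤ.* c) (map suc (upTo (suc N))) prev) ∷ prev

headℤ : List ℤ → ℤ
headℤ [] = + 0
headℤ (x ∷ _) = x

c : ℕ → ℕ → ℕ → ℤ
c r s N = headℤ (cList r s N)

{-# OPTIONS --safe #-}
module Submission where

-- Modulo 2, Ψ(-q⁹,q⁵) ≡ F(q) := Σ_{x∈ℤ} q^{7x²+2x}, so Σ c₉,₅(n) qⁿ ≡ 1/F. Squaring is q ↦ q² on
-- 𝔽₂[[q]], hence F⁸ = F(q⁸) and 1/F = F(q)F(q²)F(q⁴)/F(q⁸). Reading off the coefficients of
-- q^{8K+7}, the series Σ_K c(8K+7) q^K times F is the number of (x,y,z) with
-- f(x)+2f(y)+4f(z) = 8K+7, f(x) = 7x²+2x. The substitution (x,y,z) = (-2n-2b-1, -2a-1, b-n) matches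
-- these with the solutions of f(n)+e(a,b) = K, e(a,b) = 7a²+6a+7b²+4b+1, so after cancelling F,
-- c(8K+7) is the parity of #{(a,b) : e(a,b) = K}. Such a solution makes 7K+6 = (7a+3)²+(7b+2)² a sum
-- of two squares, while for the index of the theorem 7K+6 = p^{2m+1}·8^k(7n+6p) with p ∤ 8^k(7n+6p),
-- which is impossible for p ≡ 3 (mod 4).

open import Algebra.Bundles using (CommutativeRing)
import Algebra.Properties.CommutativeSemiring.Binomial as Binomial
open import Data.Bool using (Bool; true; false; _∧_; _xor_; not; T)
open import Data.Bool.Properties
  using (∧-assoc; ∧-comm; ∧-zeroʳ; ∧-identityʳ; ∧-idem; ∧-inverseʳ; ∧-distribˡ-xor; ∧-distribʳ-xor;
         xor-assoc; xor-comm; xor-same; xor-identityʳ; not-distribˡ-xor; not-involutive;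
         xor-annihilates-not; xor-∧-commutativeRing)
open import Data.Empty using (⊥-elim)
open import Data.Fin as Fin using (Fin; toℕ; fromℕ; inject₁)
open import Data.Fin.Properties using (toℕ-fromℕ; toℕ-inject₁; toℕ<n)
open import Data.Integer as ℤ using (ℤ; +_; -[1+_]; -_; ∣_∣)
import Data.Integer.Properties as ℤ
open import Data.Integer.Divisibility using (_∣_)
import Data.Integer.Tactic.RingSolver as ℤ-Solver
open import Data.List using (List; []; _∷_; map; _++_; cartesianProduct; upTo; applyUpTo; applyDownFrom; zipWith)
open import Data.List.Properties using (upTo-∷ʳ; map-upTo)
open import Data.Nat as ℕ
  using (ℕ; zero; suc; _+_; _*_; _^_; _∸_; _≤_; _<_; z≤n; s≤s; NonZero; _!; _≡ᵇ_; _<ᵇ_)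
import Data.Nat.Properties as ℕ
open import Data.Nat.Combinatorics using (nCn≡1; nCk≡nC[n∸k]; k![n∸k]!∣n!) renaming (_C_ to _choose_)
open import Data.Nat.Combinatorics.Specification using (nCk≡n!/k![n-k]!)
open import Data.Nat.DivMod using (_/_; _%_; m*n/n≡m; m/n*n≡m; m≡m%n+[m/n]*n; m∣n⇒o%n%m≡o%m)
open import Data.Nat.Divisibility
  using (divides; ∣m∣n⇒∣m+n; ∣m+n∣m⇒∣n; ∣⇒≤; ∣m⇒∣m*n; ∣n⇒∣m*n; m∣m*n; ∣-trans; _∣?_)
  renaming (_∣_ to _∣ℕ_)
open import Data.Nat.Primality using (Prime; euclidsLemma; prime⇒nonZero; prime⇒nonTrivial)
open import Data.Nat.Tactic.RingSolver using (solve-∀)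
open import Data.Product using (_×_; _,_; ∃; proj₁; proj₂)
open import Data.Product.Properties using (≡-dec)
open import Data.Sum using (_⊎_; inj₁; inj₂)
open import Data.Vec.Functional using (init)
open import Function using (_∘_; _$_)
open import Relation.Binary.Definitions using (DecidableEquality)
open import Relation.Binary.PropositionalEquality
open import Relation.Nullary using (¬_; yes; no)
open import Relation.Nullary.Decidable using (does; dec-true; dec-false)
open import Defs

open CommutativeRing xor-∧-commutativeRing using (+-commutativeSemigroup)
open import Algebra.Properties.CommutativeSemigroup +-commutativeSemigroup using (interchange)
open import Algebra.Properties.Monoid.Sum ℕ.+-0-monoid using (sum-init-last) renaming (sum to ∑)
import Algebra.Properties.Semiring.Exp ℕ.+-*-semiring as SemiringExp
import Algebra.Properties.Semiring.Mult ℕ.+-*-semiring as SemiringMult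
open Binomial ℕ.+-*-commutativeSemiring using (binomialTerm; binomial) renaming (theorem to binomial-theorem)

private variable
  X Y : Set

⊕ : List X → (X → Bool) → Bool
⊕ []       f = false
⊕ (x ∷ xs) f = f x xor ⊕ xs f

⊕-cong : ∀ (xs : List X) {f g : X → Bool} → (∀ x → f x ≡ g x) → ⊕ xs f ≡ ⊕ xs g
⊕-cong []       f≗g = refl
⊕-cong (x ∷ xs) f≗g = cong₂ _xor_ (f≗g x) (⊕-cong xs f≗g)

⊕-false : ∀ (xs : List X) → ⊕ xs (λ _ → false) ≡ false
⊕-false []       = refl
⊕-false (x ∷ xs) = ⊕-false xs

⊕-xor : ∀ (xs : List X) (f g : X → Bool) → ⊕ xs (λ x → f x xor g x) ≡ ⊕ xs f xor ⊕ xs g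
⊕-xor []       f g = refl
⊕-xor (x ∷ xs) f g =
  trans (cong ((f x xor g x) xor_) (⊕-xor xs f g)) (interchange (f x) (g x) (⊕ xs f) (⊕ xs g))

∧-distribˡ-⊕ : ∀ b (xs : List X) (f : X → Bool) → b ∧ ⊕ xs f ≡ ⊕ xs (λ x → b ∧ f x)
∧-distribˡ-⊕ b []       f = ∧-zeroʳ b
∧-distribˡ-⊕ b (x ∷ xs) f =
  trans (∧-distribˡ-xor b (f x) (⊕ xs f)) (cong ((b ∧ f x) xor_) (∧-distribˡ-⊕ b xs f))

∧-distribʳ-⊕ : ∀ b (xs : List X) (f : X → Bool) → ⊕ xs f ∧ b ≡ ⊕ xs (λ x → f x ∧ b)
∧-distribʳ-⊕ b xs f =
  trans (∧-comm (⊕ xs f) b) (trans (∧-distribˡ-⊕ b xs f) (⊕-cong xs (λ x → ∧-comm b (f x))))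

⊕-comm : ∀ (xs : List X) (ys : List Y) (f : X → Y → Bool) →
         ⊕ xs (λ x → ⊕ ys (f x)) ≡ ⊕ ys (λ y → ⊕ xs (λ x → f x y))
⊕-comm []       ys f = sym (⊕-false ys)
⊕-comm (x ∷ xs) ys f =
  trans (cong (⊕ ys (f x) xor_) (⊕-comm xs ys f)) (sym (⊕-xor ys (f x) (λ y → ⊕ xs (λ x → f x y))))

⊕-++ : ∀ (xs ys : List X) (f : X → Bool) → ⊕ (xs ++ ys) f ≡ ⊕ xs f xor ⊕ ys f
⊕-++ []       ys f = refl
⊕-++ (x ∷ xs) ys f = trans (cong (f x xor_) (⊕-++ xs ys f)) (sym (xor-assoc (f x) (⊕ xs f) (⊕ ys f)))

⊕-map : ∀ (g : X → Y) (xs : List X) (f : Y → Bool) → ⊕ (map g xs) f ≡ ⊕ xs (f ∘ g)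
⊕-map g []       f = refl
⊕-map g (x ∷ xs) f = cong (f (g x) xor_) (⊕-map g xs f)

⊕-cartesianProduct : ∀ (xs : List X) (ys : List Y) (f : X × Y → Bool) →
                     ⊕ (cartesianProduct xs ys) f ≡ ⊕ xs (λ x → ⊕ ys (λ y → f (x , y)))
⊕-cartesianProduct []       ys f = refl
⊕-cartesianProduct (x ∷ xs) ys f =
  trans (⊕-++ (map (x ,_) ys) (cartesianProduct xs ys) f)
        (cong₂ _xor_ (⊕-map (x ,_) ys f) (⊕-cartesianProduct xs ys f))

⊕-∧-⊕ : ∀ (xs : List X) (ys : List Y) (f : X → Bool) (g : Y → Bool) →
        ⊕ xs f ∧ ⊕ ys g ≡ ⊕ (cartesianProduct xs ys) (λ (x , y) → f x ∧ g y)
⊕-∧-⊕ xs ys f g = begin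
  ⊕ xs f ∧ ⊕ ys g                                    ≡⟨ ∧-distribʳ-⊕ (⊕ ys g) xs f ⟩
  ⊕ xs (λ x → f x ∧ ⊕ ys g)                          ≡⟨ ⊕-cong xs (λ x → ∧-distribˡ-⊕ (f x) ys g) ⟩
  ⊕ xs (λ x → ⊕ ys (λ y → f x ∧ g y))                ≡⟨ ⊕-cartesianProduct xs ys (λ (x , y) → f x ∧ g y) ⟨
  ⊕ (cartesianProduct xs ys) (λ (x , y) → f x ∧ g y) ∎
  where open ≡-Reasoning

⊕≡true⇒∃ : ∀ (xs : List X) (f : X → Bool) → ⊕ xs f ≡ true → ∃ λ x → f x ≡ true
⊕≡true⇒∃ (x ∷ xs) f ⊕≡true with f x in fx≡
... | true  = x , fx≡
... | false = ⊕≡true⇒∃ xs f ⊕≡true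

odd : ℕ → Bool
odd zero    = false
odd (suc n) = not (odd n)

odd-+ : ∀ m n → odd (m + n) ≡ odd m xor odd n
odd-+ zero    n = refl
odd-+ (suc m) n = trans (cong not (odd-+ m n)) (not-distribˡ-xor (odd m) (odd n))

odd-* : ∀ m n → odd (m * n) ≡ odd m ∧ odd n
odd-* zero    n = refl
odd-* (suc m) n = begin
  odd (n + m * n)             ≡⟨ odd-+ n (m * n) ⟩
  odd n xor odd (m * n)       ≡⟨ cong (odd n xor_) (odd-* m n) ⟩
  odd n xor (odd m ∧ odd n)   ≡⟨ absorb (odd m) (odd n) ⟩
  not (odd m) ∧ odd n         ∎
  where
  open ≡-Reasoning
  absorb : ∀ a b → b xor (a ∧ b) ≡ not a ∧ b
  absorb true  b = xor-same b
  absorb false b = xor-identityʳ b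

odd-∸ : ∀ {m n} → n ≤ m → odd (m ∸ n) ≡ odd m xor odd n
odd-∸ {m} {n} n≤m = begin
  odd (m ∸ n)                         ≡⟨ xor-cancelʳ (odd (m ∸ n)) (odd n) ⟨
  (odd (m ∸ n) xor odd n) xor odd n   ≡⟨ cong (_xor odd n) (odd-+ (m ∸ n) n) ⟨
  odd (m ∸ n + n) xor odd n           ≡⟨ cong (λ k → odd k xor odd n) (ℕ.m∸n+n≡m n≤m) ⟩
  odd m xor odd n                     ∎
  where
  open ≡-Reasoning
  xor-cancelʳ : ∀ a b → (a xor b) xor b ≡ a
  xor-cancelʳ a b = trans (xor-assoc a b b) (trans (cong (a xor_) (xor-same b)) (xor-identityʳ a))

odd-2* : ∀ k → odd (2 * k) ≡ false
odd-2* k = odd-* 2 k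

even⊎odd : ∀ n → ∃ λ k → n ≡ 2 * k ⊎ n ≡ suc (2 * k)
even⊎odd zero    = 0 , inj₁ refl
even⊎odd (suc n) with even⊎odd n
... | k , inj₁ refl = k , inj₂ refl
... | k , inj₂ refl = suc k , inj₁ (sym (ℕ.*-suc 2 k))

2*≢suc[2*] : ∀ m k → 2 * m ≢ suc (2 * k)
2*≢suc[2*] m k eq with trans (sym (odd-2* m)) (trans (cong odd eq) (cong not (odd-2* k)))
... | ()

odd≡false⇒2∣ : ∀ n → odd n ≡ false → 2 ∣ℕ n
odd≡false⇒2∣ n odd≡false with even⊎odd n
... | k , inj₁ refl = divides k (ℕ.*-comm 2 k)
... | k , inj₂ refl with trans (sym (cong not (odd-2* k))) odd≡false
...   | ()

oddℤ : ℤ → Bool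
oddℤ i = odd ∣ i ∣

oddℤ-⊖ : ∀ m n → oddℤ (m ℤ.⊖ n) ≡ odd m xor odd n
oddℤ-⊖ m n with ℕ.≤-total n m
... | inj₁ n≤m = trans (cong oddℤ (ℤ.⊖-≥ n≤m)) (odd-∸ n≤m)
... | inj₂ m≤n = trans (cong odd (ℤ.∣⊖∣-≤ m≤n)) (trans (odd-∸ m≤n) (xor-comm (odd n) (odd m)))

oddℤ-+ : ∀ i j → oddℤ (i ℤ.+ j) ≡ oddℤ i xor oddℤ j
oddℤ-+ (+ m)    (+ n)    = odd-+ m n
oddℤ-+ (+ m)    -[1+ n ] = oddℤ-⊖ m (suc n)
oddℤ-+ -[1+ m ] (+ n)    = trans (oddℤ-⊖ n (suc m)) (xor-comm (odd n) (not (odd m)))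
oddℤ-+ -[1+ m ] -[1+ n ] =
  trans (not-involutive (odd (m + n))) (trans (odd-+ m n) (sym (xor-annihilates-not (odd m) (odd n))))

oddℤ-* : ∀ i j → oddℤ (i ℤ.* j) ≡ oddℤ i ∧ oddℤ j
oddℤ-* i j = trans (cong odd (ℤ.abs-* i j)) (odd-* ∣ i ∣ ∣ j ∣)

oddℤ-neg : ∀ i → oddℤ (- i) ≡ oddℤ i
oddℤ-neg i = cong odd (ℤ.∣-i∣≡∣i∣ i)

oddℤ-sum : ∀ xs → oddℤ (sum xs) ≡ ⊕ xs oddℤ
oddℤ-sum []       = refl
oddℤ-sum (x ∷ xs) = trans (oddℤ-+ x (sum xs)) (cong (oddℤ x xor_) (oddℤ-sum xs))

oddℤ-2*+1 : ∀ q → oddℤ (+ 2 ℤ.* q ℤ.+ + 1) ≡ true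
oddℤ-2*+1 q = trans (oddℤ-+ (+ 2 ℤ.* q) (+ 1)) (cong (_xor true) (oddℤ-* (+ 2) q))

oddℤ≡false⇒2∣ : ∀ i → oddℤ i ≡ false → + 2 ∣ i
oddℤ≡false⇒2∣ i = odd≡false⇒2∣ ∣ i ∣

oddℤ≡true⇒∃ : ∀ i → oddℤ i ≡ true → ∃ λ q → i ≡ + 2 ℤ.* q ℤ.+ + 1
oddℤ≡true⇒∃ (+ n) odd-n with even⊎odd n
... | k , inj₁ refl with trans (sym (odd-2* k)) odd-n
...   | ()
oddℤ≡true⇒∃ (+ n) odd-n | k , inj₂ refl = + k , trans (cong (λ j → + 1 ℤ.+ j) (ℤ.pos-* 2 k)) (shift (+ k))
  where
  shift : ∀ q → + 1 ℤ.+ + 2 ℤ.* q ≡ + 2 ℤ.* q ℤ.+ + 1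
  shift = ℤ-Solver.solve-∀
oddℤ≡true⇒∃ -[1+ n ] odd-1+n with even⊎odd n
... | k , inj₁ refl = - (+ k) ℤ.- + 1 , trans (cong (λ j → - (+ 1 ℤ.+ j)) (ℤ.pos-* 2 k)) (shift (+ k))
  where
  shift : ∀ q → - (+ 1 ℤ.+ + 2 ℤ.* q) ≡ + 2 ℤ.* (- q ℤ.- + 1) ℤ.+ + 1
  shift = ℤ-Solver.solve-∀
... | k , inj₂ refl with trans (sym (cong (not ∘ not) (odd-2* k))) odd-1+n
...   | ()

≡ᵇ-true⇒≡ : ∀ {m n} → (m ≡ᵇ n) ≡ true → m ≡ n
≡ᵇ-true⇒≡ {m} {n} eq = ℕ.≡ᵇ⇒≡ m n (subst T (sym eq) _)

≡⇒≡ᵇ-true : ∀ {m n} → m ≡ n → (m ≡ᵇ n) ≡ true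
≡⇒≡ᵇ-true {m} {n} = dec-true (m ℕ.≟ n)

≡ᵇ-injective : ∀ {f : ℕ → ℕ} → (∀ {m n} → f m ≡ f n → m ≡ n) → ∀ m n → (f m ≡ᵇ f n) ≡ (m ≡ᵇ n)
≡ᵇ-injective {f} f-injective m n with m ℕ.≟ n
... | yes refl = trans (dec-true (f m ℕ.≟ f m) refl) (sym (dec-true (m ℕ.≟ m) refl))
... | no  m≢n  = trans (dec-false (f m ℕ.≟ f n) (m≢n ∘ f-injective)) (sym (dec-false (m ℕ.≟ n) m≢n))

-- Power series over 𝔽₂ = (Bool, xor, ∧)

Series : Set
Series = ℕ → Bool

tail : Series → Series
tail A = A ∘ suc

infixl 7 _·_
_·_ : Series → Series → Series
(A · B) zero    = A 0 ∧ B 0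
(A · B) (suc n) = (A 0 ∧ B (suc n)) xor (tail A · B) n

0# 1# : Series
0# _       = false
1# zero    = true
1# (suc _) = false

infix 4 _≗[≤_]_
_≗[≤_]_ : Series → ℕ → Series → Set
A ≗[≤ n ] B = ∀ k → k ≤ n → A k ≡ B k

·-cong-≤ : ∀ n {A A′ B B′} → A ≗[≤ n ] A′ → B ≗[≤ n ] B′ → A · B ≗[≤ n ] A′ · B′
·-cong-≤ n A≗A′ B≗B′ k k≤n = coefficient k (λ j j≤k → A≗A′ j (ℕ.≤-trans j≤k k≤n)) (λ j j≤k → B≗B′ j (ℕ.≤-trans j≤k k≤n))
  where
  coefficient : ∀ k {A A′ B B′} → A ≗[≤ k ] A′ → B ≗[≤ k ] B′ → (A · B) k ≡ (A′ · B′) k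
  coefficient zero    A≗A′ B≗B′ = cong₂ _∧_ (A≗A′ 0 z≤n) (B≗B′ 0 z≤n)
  coefficient (suc k) A≗A′ B≗B′ =
    cong₂ _xor_ (cong₂ _∧_ (A≗A′ 0 z≤n) (B≗B′ (suc k) ℕ.≤-refl))
                (coefficient k (λ j j≤k → A≗A′ (suc j) (s≤s j≤k)) (λ j j≤k → B≗B′ j (ℕ.m≤n⇒m≤1+n j≤k)))

·-cong : ∀ {A A′ B B′} → A ≗ A′ → B ≗ B′ → A · B ≗ A′ · B′
·-cong A≗A′ B≗B′ n = ·-cong-≤ n (λ k _ → A≗A′ k) (λ k _ → B≗B′ k) n ℕ.≤-refl

·-congˡ : ∀ {A B B′} → B ≗ B′ → A · B ≗ A · B′
·-congˡ = ·-cong (λ _ → refl)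

·-congʳ : ∀ {A A′ B} → A ≗ A′ → A · B ≗ A′ · B
·-congʳ A≗A′ = ·-cong A≗A′ (λ _ → refl)

·-suc : ∀ A B n → (A · B) (suc n) ≡ (A · tail B) n xor (A (suc n) ∧ B 0)
·-suc A B zero    = refl
·-suc A B (suc n) = begin
  (A 0 ∧ B (2 + n)) xor (tail A · B) (suc n)                         ≡⟨ cong ((A 0 ∧ B (2 + n)) xor_) (·-suc (tail A) B n) ⟩
  (A 0 ∧ B (2 + n)) xor ((tail A · tail B) n xor (A (2 + n) ∧ B 0))  ≡⟨ xor-assoc (A 0 ∧ B (2 + n)) _ _ ⟨
  (A · tail B) (suc n) xor (A (2 + n) ∧ B 0)                         ∎
  where open ≡-Reasoning

·-comm : ∀ A B → A · B ≗ B · A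
·-comm A B zero    = ∧-comm (A 0) (B 0)
·-comm A B (suc n) = begin
  (A 0 ∧ B (suc n)) xor (tail A · B) n   ≡⟨ cong₂ _xor_ (∧-comm (A 0) (B (suc n))) (·-comm (tail A) B n) ⟩
  (B (suc n) ∧ A 0) xor (B · tail A) n   ≡⟨ xor-comm (B (suc n) ∧ A 0) _ ⟩
  (B · tail A) n xor (B (suc n) ∧ A 0)   ≡⟨ ·-suc B A n ⟨
  (B · A) (suc n)                        ∎
  where open ≡-Reasoning

·-zeroˡ : ∀ A → 0# · A ≗ 0#
·-zeroˡ A zero    = refl
·-zeroˡ A (suc n) = ·-zeroˡ A n

·-identityˡ : ∀ A → 1# · A ≗ A
·-identityˡ A zero    = refl
·-identityˡ A (suc n) = trans (cong (A (suc n) xor_) (·-zeroˡ A n)) (xor-identityʳ (A (suc n)))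

·-identityʳ : ∀ A → A · 1# ≗ A
·-identityʳ A n = trans (·-comm A 1# n) (·-identityˡ A n)

·-∧ˡ : ∀ b A B → (λ k → b ∧ A k) · B ≗ (λ n → b ∧ (A · B) n)
·-∧ˡ b A B zero    = ∧-assoc b (A 0) (B 0)
·-∧ˡ b A B (suc n) =
  trans (cong₂ _xor_ (∧-assoc b (A 0) (B (suc n))) (·-∧ˡ b (tail A) B n)) (sym (∧-distribˡ-xor b _ _))

·-distribʳ-xor : ∀ A A′ B → (λ k → A k xor A′ k) · B ≗ (λ n → (A · B) n xor (A′ · B) n)
·-distribʳ-xor A A′ B zero    = ∧-distribʳ-xor (B 0) (A 0) (A′ 0)
·-distribʳ-xor A A′ B (suc n) =
  trans (cong₂ _xor_ (∧-distribʳ-xor (B (suc n)) (A 0) (A′ 0)) (·-distribʳ-xor (tail A) (tail A′) B n))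
        (interchange (A 0 ∧ B (suc n)) (A′ 0 ∧ B (suc n)) ((tail A · B) n) ((tail A′ · B) n))

·-assoc : ∀ A B C → (A · B) · C ≗ A · (B · C)
·-assoc A B C zero    = ∧-assoc (A 0) (B 0) (C 0)
·-assoc A B C (suc n) = begin
  (a ∧ C (suc n)) xor (tail (A · B) · C) n
    ≡⟨ cong ((a ∧ C (suc n)) xor_) (·-distribʳ-xor (λ k → A 0 ∧ B (suc k)) (tail A · B) C n) ⟩
  (a ∧ C (suc n)) xor (((λ k → A 0 ∧ B (suc k)) · C) n xor ((tail A · B) · C) n)
    ≡⟨ cong₂ (λ u v → (a ∧ C (suc n)) xor (u xor v)) (·-∧ˡ (A 0) (tail B) C n) (·-assoc (tail A) B C n) ⟩
  (a ∧ C (suc n)) xor ((A 0 ∧ (tail B · C) n) xor (tail A · (B · C)) n)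
    ≡⟨ xor-assoc (a ∧ C (suc n)) (A 0 ∧ (tail B · C) n) _ ⟨
  ((a ∧ C (suc n)) xor (A 0 ∧ (tail B · C) n)) xor (tail A · (B · C)) n
    ≡⟨ cong (λ u → (u xor (A 0 ∧ (tail B · C) n)) xor (tail A · (B · C)) n) (∧-assoc (A 0) (B 0) (C (suc n))) ⟩
  ((A 0 ∧ (B 0 ∧ C (suc n))) xor (A 0 ∧ (tail B · C) n)) xor (tail A · (B · C)) n
    ≡⟨ cong (_xor (tail A · (B · C)) n) (∧-distribˡ-xor (A 0) (B 0 ∧ C (suc n)) _) ⟨
  (A 0 ∧ (B · C) (suc n)) xor (tail A · (B · C)) n
    ∎
  where
  open ≡-Reasoning
  a : Bool
  a = A 0 ∧ B 0

·-cancelʳ : ∀ {A B F C} → F · C ≗ 1# → A · F ≗ B · F → A ≗ B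
·-cancelʳ {A} {B} {F} {C} F·C≗1 A·F≗B·F n = begin
  A n                ≡⟨ ·-identityʳ A n ⟨
  (A · 1#) n         ≡⟨ ·-congˡ F·C≗1 n ⟨
  (A · (F · C)) n    ≡⟨ ·-assoc A F C n ⟨
  ((A · F) · C) n    ≡⟨ ·-congʳ A·F≗B·F n ⟩
  ((B · F) · C) n    ≡⟨ ·-assoc B F C n ⟩
  (B · (F · C)) n    ≡⟨ ·-congˡ F·C≗1 n ⟩
  (B · 1#) n         ≡⟨ ·-identityʳ B n ⟩
  B n                ∎
  where open ≡-Reasoning

dilate₂ : Series → Series
dilate₂ A zero          = A 0
dilate₂ A (suc zero)    = false
dilate₂ A (suc (suc n)) = dilate₂ (tail A) n

dilate₂-even : ∀ A k → dilate₂ A (2 * k) ≡ A k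
dilate₂-even A zero    = refl
dilate₂-even A (suc k) = trans (cong (dilate₂ A) (ℕ.*-suc 2 k)) (dilate₂-even (tail A) k)

dilate₂-odd : ∀ A k → dilate₂ A (suc (2 * k)) ≡ false
dilate₂-odd A zero    = refl
dilate₂-odd A (suc k) = trans (cong (dilate₂ A ∘ suc) (ℕ.*-suc 2 k)) (dilate₂-odd (tail A) k)

dilate₂-cong-≤ : ∀ {A B} n → A ≗[≤ n ] B → dilate₂ A ≗[≤ n ] dilate₂ B
dilate₂-cong-≤ {A} {B} n A≗B j j≤n with even⊎odd j
... | k , inj₁ refl = trans (dilate₂-even A k) (trans (A≗B k (ℕ.≤-trans (ℕ.m≤n*m k 2) j≤n)) (sym (dilate₂-even B k)))
... | k , inj₂ refl = trans (dilate₂-odd A k) (sym (dilate₂-odd B k))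

·-self : ∀ A → A · A ≗ dilate₂ A
·-self A zero          = ∧-idem (A 0)
·-self A (suc zero)    = trans (cong ((A 0 ∧ A 1) xor_) (∧-comm (A 1) (A 0))) (xor-same (A 0 ∧ A 1))
·-self A (suc (suc n)) = begin
  a xor (tail A · A) (suc n)                          ≡⟨ cong (a xor_) (·-suc (tail A) A n) ⟩
  a xor ((tail A · tail A) n xor (A (2 + n) ∧ A 0))   ≡⟨ cong (λ b → a xor ((tail A · tail A) n xor b)) (∧-comm (A (2 + n)) (A 0)) ⟩
  a xor ((tail A · tail A) n xor a)                   ≡⟨ xor-absorbs a _ ⟩
  (tail A · tail A) n                                 ≡⟨ ·-self (tail A) n ⟩
  dilate₂ (tail A) n                                  ∎
  where
  open ≡-Reasoning
  a : Bool
  a = A 0 ∧ A (2 + n)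
  xor-absorbs : ∀ a b → a xor (b xor a) ≡ b
  xor-absorbs false b     = xor-identityʳ b
  xor-absorbs true  false = refl
  xor-absorbs true  true  = refl

·-square : ∀ A B → A · (A · B) ≗ dilate₂ A · B
·-square A B n = trans (sym (·-assoc A A B n)) (·-congʳ (·-self A) n)

oddPart : Series → Series
oddPart A zero    = A 1
oddPart A (suc k) = oddPart (tail (tail A)) k

oddPart-spec : ∀ A k → oddPart A k ≡ A (suc (2 * k))
oddPart-spec A zero    = refl
oddPart-spec A (suc k) = trans (oddPart-spec (tail (tail A)) k) (cong (A ∘ suc) (sym (ℕ.*-suc 2 k)))

·-dilate₂-odd : ∀ A B K → (A · dilate₂ B) (suc (2 * K)) ≡ (oddPart A · B) K
·-dilate₂-odd A B zero    = cong (_xor (A 1 ∧ B 0)) (∧-zeroʳ (A 0))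
·-dilate₂-odd A B (suc K) = trans (cong (λ j → (A · dilate₂ B) (suc j)) (ℕ.*-suc 2 K)) $ begin
  (A 0 ∧ dilate₂ B (3 + 2 * K)) xor ((A 1 ∧ dilate₂ B (2 + 2 * K)) xor (tail (tail A) · dilate₂ B) (suc (2 * K)))
    ≡⟨ cong₂ _xor_ (trans (cong (A 0 ∧_) (dilate₂-odd (tail B) K)) (∧-zeroʳ (A 0)))
                   (cong₂ _xor_ (cong (A 1 ∧_) (dilate₂-even (tail B) K)) (·-dilate₂-odd (tail (tail A)) B K)) ⟩
  (oddPart A · B) (suc K)
    ∎
  where open ≡-Reasoning

monomial : ℕ → Series
monomial d n = d ≡ᵇ n

count : List X → (X → ℕ) → Series
count xs w n = ⊕ xs (λ x → w x ≡ᵇ n)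

monomial-·-count : ∀ d (ys : List Y) w → monomial d · count ys w ≗ count ys (λ y → d + w y)
monomial-·-count zero    ys w n       = trans (·-congʳ monomial-zero n) (·-identityˡ (count ys w) n)
  where
  monomial-zero : monomial 0 ≗ 1#
  monomial-zero zero    = refl
  monomial-zero (suc _) = refl
monomial-·-count (suc d) ys w zero    = sym (⊕-false ys)
monomial-·-count (suc d) ys w (suc n) = monomial-·-count d ys w n

count-· : ∀ (xs : List X) (ys : List Y) v w →
          count xs v · count ys w ≗ count (cartesianProduct xs ys) (λ (x , y) → v x + w y)
count-· []       ys v w n = ·-zeroˡ (count ys w) n
count-· (x ∷ xs) ys v w n = begin
  (count (x ∷ xs) v · count ys w) n
    ≡⟨ ·-distribʳ-xor (monomial (v x)) (count xs v) (count ys w) n ⟩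
  (monomial (v x) · count ys w) n xor (count xs v · count ys w) n
    ≡⟨ cong₂ _xor_ (monomial-·-count (v x) ys w n) (count-· xs ys v w n) ⟩
  count ys (λ y → v x + w y) n xor count (cartesianProduct xs ys) (λ (x , y) → v x + w y) n
    ≡⟨ cong (_xor _) (⊕-map (x ,_) ys (λ (x , y) → v x + w y ≡ᵇ n)) ⟨
  count (map (x ,_) ys) (λ (x , y) → v x + w y) n xor count (cartesianProduct xs ys) (λ (x , y) → v x + w y) n
    ≡⟨ ⊕-++ (map (x ,_) ys) (cartesianProduct xs ys) (λ (x , y) → v x + w y ≡ᵇ n) ⟨
  count (cartesianProduct (x ∷ xs) ys) (λ (x , y) → v x + w y) n
    ∎
  where open ≡-Reasoning

dilate₂-count : ∀ (xs : List X) w → dilate₂ (count xs w) ≗ count xs (λ x → 2 * w x)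
dilate₂-count xs w j with even⊎odd j
... | k , inj₁ refl = trans (dilate₂-even (count xs w) k)
                            (⊕-cong xs (λ x → sym (≡ᵇ-injective (ℕ.*-cancelˡ-≡ _ _ 2) (w x) k)))
... | k , inj₂ refl = trans (dilate₂-odd (count xs w) k)
                            (sym (trans (⊕-cong xs (λ x → dec-false (2 * w x ℕ.≟ suc (2 * k)) (2*≢suc[2*] (w x) k)))
                                        (⊕-false xs)))

⊕-upTo-suc : ∀ n (h : ℕ → Bool) → ⊕ (upTo (suc n)) h ≡ ⊕ (upTo n) h xor h n
⊕-upTo-suc n h = begin
  ⊕ (upTo (suc n)) h                 ≡⟨ cong (λ l → ⊕ l h) (upTo-∷ʳ n) ⟨
  ⊕ (upTo n ++ n ∷ []) h             ≡⟨ ⊕-++ (upTo n) (n ∷ []) h ⟩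
  ⊕ (upTo n) h xor (h n xor false)   ≡⟨ cong (⊕ (upTo n) h xor_) (xor-identityʳ (h n)) ⟩
  ⊕ (upTo n) h xor h n               ∎
  where open ≡-Reasoning

⊕-upTo-mono : ∀ {n n′} (h : ℕ → Bool) → (∀ k → n ≤ k → h k ≡ false) → n ≤ n′ → ⊕ (upTo n′) h ≡ ⊕ (upTo n) h
⊕-upTo-mono {n} h h≡false n≤n′ with ℕ.m≤n⇒∃[o]m+o≡n n≤n′
... | d , refl = extend d
  where
  extend : ∀ d → ⊕ (upTo (n + d)) h ≡ ⊕ (upTo n) h
  extend zero    = cong (λ m → ⊕ (upTo m) h) (ℕ.+-identityʳ n)
  extend (suc d) = begin
    ⊕ (upTo (n + suc d)) h             ≡⟨ cong (λ m → ⊕ (upTo m) h) (ℕ.+-suc n d) ⟩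
    ⊕ (upTo (suc (n + d))) h           ≡⟨ ⊕-upTo-suc (n + d) h ⟩
    ⊕ (upTo (n + d)) h xor h (n + d)   ≡⟨ cong₂ _xor_ (extend d) (h≡false (n + d) (ℕ.m≤m+n n d)) ⟩
    ⊕ (upTo n) h xor false             ≡⟨ xor-identityʳ (⊕ (upTo n) h) ⟩
    ⊕ (upTo n) h                       ∎
    where open ≡-Reasoning

occurs : DecidableEquality X → List X → X → Bool
occurs _≟_ xs x₀ = ⊕ xs (λ x → does (x₀ ≟ x))

occurs-upTo : ∀ n m → occurs ℕ._≟_ (upTo n) m ≡ (m <ᵇ n)
occurs-upTo zero    zero    = refl
occurs-upTo zero    (suc m) = refl
occurs-upTo (suc n) m =
  trans (⊕-upTo-suc n (m ≡ᵇ_)) (trans (cong (_xor (m ≡ᵇ n)) (occurs-upTo n m)) (<ᵇ-step m n))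
  where
  <ᵇ-step : ∀ m n → (m <ᵇ n) xor (m ≡ᵇ n) ≡ (m <ᵇ suc n)
  <ᵇ-step zero    zero    = refl
  <ᵇ-step zero    (suc n) = refl
  <ᵇ-step (suc m) zero    = refl
  <ᵇ-step (suc m) (suc n) = <ᵇ-step m n

occurs-cartesianProduct : ∀ (_≟₁_ : DecidableEquality X) (_≟₂_ : DecidableEquality Y) xs ys x y →
  occurs (≡-dec _≟₁_ _≟₂_) (cartesianProduct xs ys) (x , y) ≡ occurs _≟₁_ xs x ∧ occurs _≟₂_ ys y
occurs-cartesianProduct _≟₁_ _≟₂_ xs ys x y =
  trans (⊕-cong (cartesianProduct xs ys) (λ (x′ , y′) → does-≡-dec x′ y′))
        (sym (⊕-∧-⊕ xs ys (λ x′ → does (x ≟₁ x′)) (λ y′ → does (y ≟₂ y′))))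
  where
  does-≡-dec : ∀ x′ y′ → does (≡-dec _≟₁_ _≟₂_ (x , y) (x′ , y′)) ≡ does (x ≟₁ x′) ∧ does (y ≟₂ y′)
  does-≡-dec x′ y′ with x ≟₁ x′
  ... | yes refl = refl
  ... | no  _    = refl

-- range n lists +0, …, +n and -1, …, -(n+1), the indices of the two sums in psiCoeff r s n.
range : ℕ → List ℤ
range n = map +_ (upTo (suc n)) ++ map -[1+_] (upTo (suc n))

⊕-range : ∀ n (f : ℤ → Bool) → ⊕ (range n) f ≡ ⊕ (upTo (suc n)) (f ∘ +_) xor ⊕ (upTo (suc n)) (f ∘ -[1+_])
⊕-range n f = trans (⊕-++ (map +_ (upTo (suc n))) (map -[1+_] (upTo (suc n))) f)
                    (cong₂ _xor_ (⊕-map +_ (upTo (suc n)) f) (⊕-map -[1+_] (upTo (suc n)) f))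

⊕-range-mono : ∀ {B B′} (f : ℤ → Bool) → (∀ x → B < ∣ x ∣ → f x ≡ false) → B ≤ B′ →
               ⊕ (range B′) f ≡ ⊕ (range B) f
⊕-range-mono {B} {B′} f f≡false B≤B′ = begin
  ⊕ (range B′) f                                                 ≡⟨ ⊕-range B′ f ⟩
  ⊕ (upTo (suc B′)) (f ∘ +_) xor ⊕ (upTo (suc B′)) (f ∘ -[1+_])  ≡⟨ cong₂ _xor_ (⊕-upTo-mono _ nonneg (s≤s B≤B′))
                                                                                 (⊕-upTo-mono _ neg (s≤s B≤B′)) ⟩
  ⊕ (upTo (suc B)) (f ∘ +_) xor ⊕ (upTo (suc B)) (f ∘ -[1+_])    ≡⟨ ⊕-range B f ⟨
  ⊕ (range B) f                                                  ∎
  where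
  open ≡-Reasoning
  nonneg : ∀ k → suc B ≤ k → f (+ k) ≡ false
  nonneg k B<k = f≡false (+ k) B<k
  neg : ∀ k → suc B ≤ k → f -[1+ k ] ≡ false
  neg k B<k = f≡false -[1+ k ] (ℕ.m≤n⇒m≤1+n B<k)

occurs-range : ∀ {B} x → ∣ x ∣ ≤ B → occurs ℤ._≟_ (range B) x ≡ true
occurs-range {B} (+ n)    n≤B = begin
  occurs ℤ._≟_ (range B) (+ n)                                       ≡⟨ ⊕-range B (λ x → does (+ n ℤ.≟ x)) ⟩
  occurs ℕ._≟_ (upTo (suc B)) n xor ⊕ (upTo (suc B)) (λ _ → false)   ≡⟨ cong₂ _xor_ (occurs-upTo (suc B) n) (⊕-false (upTo (suc B))) ⟩
  (n <ᵇ suc B) xor false                                             ≡⟨ cong (_xor false) (dec-true (n ℕ.<? suc B) (s≤s n≤B)) ⟩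
  true                                                               ∎
  where open ≡-Reasoning
occurs-range {B} -[1+ n ] n<B = begin
  occurs ℤ._≟_ (range B) -[1+ n ]                                    ≡⟨ ⊕-range B (λ x → does (-[1+ n ] ℤ.≟ x)) ⟩
  ⊕ (upTo (suc B)) (λ _ → false) xor occurs ℕ._≟_ (upTo (suc B)) n   ≡⟨ cong₂ _xor_ (⊕-false (upTo (suc B))) (occurs-upTo (suc B) n) ⟩
  n <ᵇ suc B                                                         ≡⟨ dec-true (n ℕ.<? suc B) (ℕ.m≤n⇒m≤1+n n<B) ⟩
  true                                                               ∎
  where open ≡-Reasoning

count-range-mono : ∀ (w : ℤ → ℕ) → (∀ x → ∣ x ∣ ≤ w x) → ∀ {n B} → n ≤ B →
                   count (range B) w n ≡ count (range n) w n
count-range-mono w ∣x∣≤wx {n} = ⊕-range-mono (λ x → w x ≡ᵇ n)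
  (λ x n<∣x∣ → dec-false (w x ℕ.≟ n) (λ wx≡n → ℕ.<⇒≢ (ℕ.<-≤-trans n<∣x∣ (∣x∣≤wx x)) (sym wx≡n)))

module _ {_≟X_ : DecidableEquality X} {_≟Y_ : DecidableEquality Y}
         (xs : List X) (ys : List Y) (φ : X → Bool) (ψ : Y → Bool) (σ : Y → X)
         (σ-injective : ∀ {y y′} → σ y ≡ σ y′ → y ≡ y′)
         (σ-sound : ∀ y → ψ y ≡ true → φ (σ y) ≡ true)
         (σ-onto : ∀ x → φ x ≡ true → ∃ λ y → ψ y ≡ true × σ y ≡ x)
         (xs-covers : ∀ x → φ x ≡ true → occurs _≟X_ xs x ≡ true)
         (ys-covers : ∀ y → ψ y ≡ true → occurs _≟Y_ ys y ≡ true)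
         where

  private
    fibre : ∀ x → φ x ≡ ⊕ ys (λ y → ψ y ∧ does (σ y ≟X x))
    fibre x with φ x in φx
    ... | true with σ-onto x φx
    ...   | y₀ , ψy₀ , refl = sym (trans (⊕-cong ys only-y₀) (ys-covers y₀ ψy₀))
      where
      only-y₀ : ∀ y → ψ y ∧ does (σ y ≟X σ y₀) ≡ does (y₀ ≟Y y)
      only-y₀ y with y₀ ≟Y y
      ... | yes refl = cong₂ _∧_ ψy₀ (dec-true (σ y₀ ≟X σ y₀) refl)
      ... | no y₀≢y  = trans (cong (ψ y ∧_) (dec-false (σ y ≟X σ y₀) (y₀≢y ∘ sym ∘ σ-injective))) (∧-zeroʳ (ψ y))
    fibre x | false = sym (trans (⊕-cong ys none) (⊕-false ys))
      where
      none : ∀ y → ψ y ∧ does (σ y ≟X x) ≡ false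
      none y with ψ y in ψy | σ y ≟X x
      ... | true  | yes refl = trans (sym (σ-sound y ψy)) φx
      ... | true  | no _     = refl
      ... | false | _        = refl

    counted : ∀ y → ψ y ∧ occurs _≟X_ xs (σ y) ≡ ψ y
    counted y with ψ y in ψy
    ... | true  = xs-covers (σ y) (σ-sound y ψy)
    ... | false = refl

  ⊕-reindex : ⊕ xs φ ≡ ⊕ ys ψ
  ⊕-reindex = begin
    ⊕ xs φ                                            ≡⟨ ⊕-cong xs fibre ⟩
    ⊕ xs (λ x → ⊕ ys (λ y → ψ y ∧ does (σ y ≟X x)))   ≡⟨ ⊕-comm xs ys _ ⟩
    ⊕ ys (λ y → ⊕ xs (λ x → ψ y ∧ does (σ y ≟X x)))   ≡⟨ ⊕-cong ys (λ y → ∧-distribˡ-⊕ (ψ y) xs _) ⟨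
    ⊕ ys (λ y → ψ y ∧ occurs _≟X_ xs (σ y))           ≡⟨ ⊕-cong ys counted ⟩
    ⊕ ys ψ                                            ∎
    where open ≡-Reasoning

-- Ψ(-qʳ, qˢ) modulo 2

Ψ₂ : ℕ → ℕ → Series
Ψ₂ r s n = oddℤ (psiCoeff r s n)

c₂ : ℕ → ℕ → Series
c₂ r s n = oddℤ (c r s n)

oddℤ-Cauchy : ∀ (f g : ℕ → ℤ) (u : ℕ → ℕ) N →
  oddℤ (sum (zipWith (λ i x → f i ℤ.* x) (applyUpTo u (suc N)) (applyDownFrom g (suc N))))
    ≡ ((oddℤ ∘ f ∘ u) · (oddℤ ∘ g)) N
oddℤ-Cauchy f g u zero    =
  trans (oddℤ-+ (f (u 0) ℤ.* g 0) (+ 0)) (trans (xor-identityʳ _) (oddℤ-* (f (u 0)) (g 0)))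
oddℤ-Cauchy f g u (suc N) =
  trans (oddℤ-+ (f (u 0) ℤ.* g (suc N)) _)
        (cong₂ _xor_ (oddℤ-* (f (u 0)) (g (suc N))) (oddℤ-Cauchy f g (u ∘ suc) N))

cList≡applyDownFrom : ∀ r s N → cList r s N ≡ applyDownFrom (c r s) (suc N)
cList≡applyDownFrom r s zero    = refl
cList≡applyDownFrom r s (suc N) = cong (c r s (suc N) ∷_) (cList≡applyDownFrom r s N)

Ψ₂·c₂≗1 : ∀ r s → Ψ₂ r s 0 ≡ true → Ψ₂ r s · c₂ r s ≗ 1#
Ψ₂·c₂≗1 r s Ψ₂0 zero    = trans (∧-identityʳ (Ψ₂ r s 0)) Ψ₂0
Ψ₂·c₂≗1 r s Ψ₂0 (suc N) = begin
  (Ψ₂ r s 0 ∧ c₂ r s (suc N)) xor (tail (Ψ₂ r s) · c₂ r s) N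
    ≡⟨ cong (λ b → (b ∧ c₂ r s (suc N)) xor (tail (Ψ₂ r s) · c₂ r s) N) Ψ₂0 ⟩
  c₂ r s (suc N) xor (tail (Ψ₂ r s) · c₂ r s) N
    ≡⟨ cong (c₂ r s (suc N) xor_) (oddℤ-Cauchy (psiCoeff r s) (c r s) suc N) ⟨
  c₂ r s (suc N) xor oddℤ (sum (zipWith ψc (applyUpTo suc (suc N)) (applyDownFrom (c r s) (suc N))))
    ≡⟨ cong₂ (λ is cs → c₂ r s (suc N) xor oddℤ (sum (zipWith ψc is cs)))
             (map-upTo suc (suc N)) (cList≡applyDownFrom r s N) ⟨
  c₂ r s (suc N) xor oddℤ (sum (zipWith ψc (map suc (upTo (suc N))) (cList r s N)))
    ≡⟨ cong (c₂ r s (suc N) xor_) (oddℤ-neg (sum (zipWith ψc (map suc (upTo (suc N))) (cList r s N)))) ⟨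
  c₂ r s (suc N) xor c₂ r s (suc N)
    ≡⟨ xor-same (c₂ r s (suc N)) ⟩
  false
    ∎
  where
  open ≡-Reasoning
  ψc : ℕ → ℤ → ℤ
  ψc i x = psiCoeff r s i ℤ.* x

thetaExponent : ℕ → ℕ → ℤ → ℕ
thetaExponent r s (+ n)    = r * tri n + s * tri (n ∸ 1)
thetaExponent r s -[1+ k ] = r * tri k + s * tri (suc k)

Ψ₂≡count : ∀ r s N → Ψ₂ r s N ≡ count (range N) (thetaExponent r s) N
Ψ₂≡count r s N = begin
  oddℤ (sum (map nonneg (upTo (suc N))) ℤ.- sum (map neg (map suc (upTo (suc N)))))
    ≡⟨ oddℤ-+ (sum (map nonneg (upTo (suc N)))) (ℤ.- sum (map neg (map suc (upTo (suc N))))) ⟩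
  oddℤ (sum (map nonneg (upTo (suc N)))) xor oddℤ (ℤ.- sum (map neg (map suc (upTo (suc N)))))
    ≡⟨ cong (oddℤ (sum (map nonneg (upTo (suc N)))) xor_) (oddℤ-neg (sum (map neg (map suc (upTo (suc N)))))) ⟩
  oddℤ (sum (map nonneg (upTo (suc N)))) xor oddℤ (sum (map neg (map suc (upTo (suc N)))))
    ≡⟨ cong₂ _xor_ (trans (oddℤ-sum (map nonneg (upTo (suc N)))) (⊕-map nonneg (upTo (suc N)) oddℤ))
                   (trans (oddℤ-sum (map neg (map suc (upTo (suc N)))))
                          (trans (⊕-map neg (map suc (upTo (suc N))) oddℤ) (⊕-map suc (upTo (suc N)) (oddℤ ∘ neg)))) ⟩
  ⊕ (upTo (suc N)) (oddℤ ∘ nonneg) xor ⊕ (upTo (suc N)) (oddℤ ∘ neg ∘ suc)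
    ≡⟨ cong₂ _xor_ (⊕-cong (upTo (suc N)) (λ n → oddℤ-sgn*δ (tri n) (thetaExponent r s (+ n))))
                   (⊕-cong (upTo (suc N)) (λ k → oddℤ-sgn*δ (tri k) (thetaExponent r s -[1+ k ]))) ⟩
  ⊕ (upTo (suc N)) (λ n → thetaExponent r s (+ n) ≡ᵇ N) xor ⊕ (upTo (suc N)) (λ k → thetaExponent r s -[1+ k ] ≡ᵇ N)
    ≡⟨ ⊕-range N (λ x → thetaExponent r s x ≡ᵇ N) ⟨
  count (range N) (thetaExponent r s) N
    ∎
  where
  open ≡-Reasoning
  nonneg neg : ℕ → ℤ
  nonneg n = sgn (tri n) ℤ.* δ (r * tri n + s * tri (n ∸ 1)) N
  neg j    = sgn (tri (j ∸ 1)) ℤ.* δ (r * tri (j ∸ 1) + s * tri j) N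
  oddℤ-sgn*δ : ∀ t a → oddℤ (sgn t ℤ.* δ a N) ≡ (a ≡ᵇ N)
  oddℤ-sgn*δ t a with (t % 2) ≡ᵇ 0 | a ≡ᵇ N
  ... | true  | true  = refl
  ... | true  | false = refl
  ... | false | true  = refl
  ... | false | false = refl

-- quad c d x = 7x² + cx whenever c + d = 7; at x = -(k+1) this is 7k² + (7+d)k + d, so both
-- branches are visibly natural numbers.
quad : ℕ → ℕ → ℤ → ℕ
quad c d (+ n)    = 7 * (n * n) + c * n
quad c d -[1+ k ] = 7 * (k * k) + (7 + d) * k + d

quadℤ : ℕ → ℤ → ℤ
quadℤ c x = + 7 ℤ.* (x ℤ.* x) ℤ.+ + c ℤ.* x

+quad : ∀ c d → c + d ≡ 7 → ∀ x → + quad c d x ≡ quadℤ c x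
+quad c d c+d≡7 (+ n)    = cong₂ ℤ._+_ (trans (ℤ.pos-* 7 (n * n)) (cong (+ 7 ℤ.*_) (ℤ.pos-* n n))) (ℤ.pos-* c n)
+quad c d c+d≡7 -[1+ k ] = begin
  + (7 * (k * k) + (7 + d) * k + d)
    ≡⟨ cong (ℤ._+ + d) (cong₂ ℤ._+_ (trans (ℤ.pos-* 7 (k * k)) (cong (+ 7 ℤ.*_) (ℤ.pos-* k k))) (ℤ.pos-* (7 + d) k)) ⟩
  + 7 ℤ.* (+ k ℤ.* + k) ℤ.+ + (7 + d) ℤ.* + k ℤ.+ + d
    ≡⟨ subst (λ s → + s ℤ.* (+ k ℤ.* + k) ℤ.+ + (s + d) ℤ.* + k ℤ.+ + d
                      ≡ + s ℤ.* (-[1+ k ] ℤ.* -[1+ k ]) ℤ.+ + c ℤ.* -[1+ k ])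
             c+d≡7 (shift (+ c) (+ d) (+ k)) ⟩
  quadℤ c -[1+ k ]
    ∎
  where
  open ≡-Reasoning
  shift : ∀ c d k → (c ℤ.+ d) ℤ.* (k ℤ.* k) ℤ.+ ((c ℤ.+ d) ℤ.+ d) ℤ.* k ℤ.+ d
                  ≡ (c ℤ.+ d) ℤ.* (- (+ 1 ℤ.+ k) ℤ.* - (+ 1 ℤ.+ k)) ℤ.+ c ℤ.* - (+ 1 ℤ.+ k)
  shift = ℤ-Solver.solve-∀

∣∣≤quad : ∀ c d x → ∣ x ∣ ≤ quad (suc c) (suc d) x
∣∣≤quad c d (+ n)    = ℕ.≤-trans (ℕ.m≤m+n n (c * n)) (ℕ.m≤n+m _ (7 * (n * n)))
∣∣≤quad c d -[1+ k ] = ℕ.≤-trans (ℕ.≤-reflexive (ℕ.+-comm 1 k))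
  (ℕ.+-mono-≤ (ℕ.≤-trans (ℕ.m≤m+n k ((7 + d) * k)) (ℕ.m≤n+m _ (7 * (k * k)))) (s≤s z≤n))

tri*2 : ∀ n → tri n * 2 ≡ n * suc n
tri*2 n = m/n*n≡m (odd≡false⇒2∣ (n * suc n) (trans (odd-* n (suc n)) (∧-inverseʳ (odd n))))

f : ℤ → ℕ
f = quad 2 5

[9tri+5tri]*2 : ∀ a b → (9 * tri a + 5 * tri b) * 2 ≡ 9 * (a * suc a) + 5 * (b * suc b)
[9tri+5tri]*2 a b = begin
  (9 * tri a + 5 * tri b) * 2         ≡⟨ ℕ.*-distribʳ-+ 2 (9 * tri a) (5 * tri b) ⟩
  9 * tri a * 2 + 5 * tri b * 2       ≡⟨ cong₂ _+_ (ℕ.*-assoc 9 (tri a) 2) (ℕ.*-assoc 5 (tri b) 2) ⟩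
  9 * (tri a * 2) + 5 * (tri b * 2)   ≡⟨ cong₂ (λ x y → 9 * x + 5 * y) (tri*2 a) (tri*2 b) ⟩
  9 * (a * suc a) + 5 * (b * suc b)   ∎
  where open ≡-Reasoning

thetaExponent-9-5 : ∀ x → thetaExponent 9 5 x ≡ f x
thetaExponent-9-5 (+ zero)  = refl
thetaExponent-9-5 (+ suc n) = ℕ.*-cancelʳ-≡ _ _ 2 (trans ([9tri+5tri]*2 (suc n) n) (expand n))
  where
  expand : ∀ n → 9 * (suc n * suc (suc n)) + 5 * (n * suc n) ≡ (7 * (suc n * suc n) + 2 * suc n) * 2
  expand = solve-∀
thetaExponent-9-5 -[1+ k ]  = ℕ.*-cancelʳ-≡ _ _ 2 (trans ([9tri+5tri]*2 k (suc k)) (expand k))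
  where
  expand : ∀ k → 9 * (k * suc k) + 5 * (suc k * suc (suc k)) ≡ (7 * (k * k) + 12 * k + 5) * 2
  expand = solve-∀

-- The 2-dissection of 1/Ψ(-q⁹, q⁵)

ℤ³ : Set
ℤ³ = ℤ × ℤ × ℤ

_≟³_ : DecidableEquality ℤ³
_≟³_ = ≡-dec ℤ._≟_ (≡-dec ℤ._≟_ ℤ._≟_)

range² : ℕ → List (ℤ × ℤ)
range² B = cartesianProduct (range B) (range B)

range³ : ℕ → List ℤ³
range³ B = cartesianProduct (range B) (range² B)

occurs-range³ : ∀ {B} x y z → ∣ x ∣ ≤ B → ∣ y ∣ ≤ B → ∣ z ∣ ≤ B → occurs _≟³_ (range³ B) (x , y , z) ≡ true
occurs-range³ {B} x y z x≤B y≤B z≤B =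
  trans (occurs-cartesianProduct ℤ._≟_ (≡-dec ℤ._≟_ ℤ._≟_) (range B) (range² B) x (y , z))
        (cong₂ _∧_ (occurs-range x x≤B)
                   (trans (occurs-cartesianProduct ℤ._≟_ ℤ._≟_ (range B) (range B) y z)
                          (cong₂ _∧_ (occurs-range y y≤B) (occurs-range z z≤B))))

e : ℤ × ℤ → ℕ
e (a , b) = suc (quad 6 1 a + quad 4 3 b)

-- The exponents of F(q)·F(q²)·F(q⁴) and of F(q)·E(q), where E(q) = Σ_{a,b ∈ ℤ} q^{e(a,b)}.
w₁₂₄ : ℤ³ → ℕ
w₁₂₄ (x , y , z) = f x + (2 * f y + 2 * (2 * f z))

wₑ : ℤ³ → ℕ
wₑ (n , a , b) = f n + e (a , b)

w₁₂₄ℤ : ℤ³ → ℤ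
w₁₂₄ℤ (x , y , z) = quadℤ 2 x ℤ.+ + 2 ℤ.* quadℤ 2 y ℤ.+ + 4 ℤ.* quadℤ 2 z

wₑℤ : ℤ³ → ℤ
wₑℤ (n , a , b) = quadℤ 2 n ℤ.+ quadℤ 6 a ℤ.+ quadℤ 4 b ℤ.+ + 1

+f : ∀ x → + f x ≡ quadℤ 2 x
+f = +quad 2 5 refl

+w₁₂₄ : ∀ v → + w₁₂₄ v ≡ w₁₂₄ℤ v
+w₁₂₄ (x , y , z) = begin
  + (f x + (2 * f y + 2 * (2 * f z)))
    ≡⟨ cong (λ w → + f x ℤ.+ w)
            (cong₂ ℤ._+_ (ℤ.pos-* 2 (f y)) (trans (ℤ.pos-* 2 (2 * f z)) (cong (+ 2 ℤ.*_) (ℤ.pos-* 2 (f z))))) ⟩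
  + f x ℤ.+ (+ 2 ℤ.* + f y ℤ.+ + 2 ℤ.* (+ 2 ℤ.* + f z))
    ≡⟨ cong₂ (λ a bc → a ℤ.+ bc) (+f x) (cong₂ (λ b c → + 2 ℤ.* b ℤ.+ + 2 ℤ.* (+ 2 ℤ.* c)) (+f y) (+f z)) ⟩
  quadℤ 2 x ℤ.+ (+ 2 ℤ.* quadℤ 2 y ℤ.+ + 2 ℤ.* (+ 2 ℤ.* quadℤ 2 z))
    ≡⟨ lemma (quadℤ 2 x) (quadℤ 2 y) (quadℤ 2 z) ⟩
  w₁₂₄ℤ (x , y , z) ∎
  where
  open ≡-Reasoning
  lemma : ∀ A B C → A ℤ.+ (+ 2 ℤ.* B ℤ.+ + 2 ℤ.* (+ 2 ℤ.* C)) ≡ A ℤ.+ + 2 ℤ.* B ℤ.+ + 4 ℤ.* C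
  lemma = ℤ-Solver.solve-∀

+wₑ : ∀ v → + wₑ v ≡ wₑℤ v
+wₑ (n , a , b) = trans (cong₂ (λ u w → u ℤ.+ (+ 1 ℤ.+ w)) (+f n) (cong₂ ℤ._+_ (+quad 6 1 refl a) (+quad 4 3 refl b)))
                         (lemma (quadℤ 2 n) (quadℤ 6 a) (quadℤ 4 b))
  where
  lemma : ∀ A B C → A ℤ.+ (+ 1 ℤ.+ (B ℤ.+ C)) ≡ A ℤ.+ B ℤ.+ C ℤ.+ + 1
  lemma = ℤ-Solver.solve-∀

σ : ℤ³ → ℤ³
σ (n , a , b) = - (+ 2 ℤ.* (n ℤ.+ b)) ℤ.- + 1 , - (+ 2 ℤ.* a) ℤ.- + 1 , b ℤ.- n

w₁₂₄ℤ∘σ : ∀ v → w₁₂₄ℤ (σ v) ≡ + 8 ℤ.* wₑℤ v ℤ.+ + 7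
w₁₂₄ℤ∘σ (n , a , b) = identity n a b
  where
  identity : ∀ n a b →
      (+ 7 ℤ.* ((- (+ 2 ℤ.* (n ℤ.+ b)) ℤ.- + 1) ℤ.* (- (+ 2 ℤ.* (n ℤ.+ b)) ℤ.- + 1)) ℤ.+ + 2 ℤ.* (- (+ 2 ℤ.* (n ℤ.+ b)) ℤ.- + 1))
      ℤ.+ + 2 ℤ.* (+ 7 ℤ.* ((- (+ 2 ℤ.* a) ℤ.- + 1) ℤ.* (- (+ 2 ℤ.* a) ℤ.- + 1)) ℤ.+ + 2 ℤ.* (- (+ 2 ℤ.* a) ℤ.- + 1))
      ℤ.+ + 4 ℤ.* (+ 7 ℤ.* ((b ℤ.- n) ℤ.* (b ℤ.- n)) ℤ.+ + 2 ℤ.* (b ℤ.- n))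
    ≡ + 8 ℤ.* ((+ 7 ℤ.* (n ℤ.* n) ℤ.+ + 2 ℤ.* n) ℤ.+ (+ 7 ℤ.* (a ℤ.* a) ℤ.+ + 6 ℤ.* a)
               ℤ.+ (+ 7 ℤ.* (b ℤ.* b) ℤ.+ + 4 ℤ.* b) ℤ.+ + 1) ℤ.+ + 7
  identity = ℤ-Solver.solve-∀

σ-injective : ∀ {v v′} → σ v ≡ σ v′ → v ≡ v′
σ-injective {n , a , b} {n′ , a′ , b′} σv≡σv′ = cong₂ _,_ n≡n′ (cong₂ _,_ a≡a′ b≡b′)
  where
  x≡ : - (+ 2 ℤ.* (n ℤ.+ b)) ℤ.- + 1 ≡ - (+ 2 ℤ.* (n′ ℤ.+ b′)) ℤ.- + 1
  x≡ = cong proj₁ σv≡σv′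
  y≡ : - (+ 2 ℤ.* a) ℤ.- + 1 ≡ - (+ 2 ℤ.* a′) ℤ.- + 1
  y≡ = cong (proj₁ ∘ proj₂) σv≡σv′
  z≡ : b ℤ.- n ≡ b′ ℤ.- n′
  z≡ = cong (proj₂ ∘ proj₂) σv≡σv′
  a≡a′ : a ≡ a′
  a≡a′ = ℤ.*-cancelˡ-≡ (+ 2) a a′ (trans (recover-a a) (trans (cong (λ y → - y ℤ.- + 1) y≡) (sym (recover-a a′))))
    where
    recover-a : ∀ a → + 2 ℤ.* a ≡ - (- (+ 2 ℤ.* a) ℤ.- + 1) ℤ.- + 1
    recover-a = ℤ-Solver.solve-∀
  n≡n′ : n ≡ n′
  n≡n′ = ℤ.*-cancelˡ-≡ (+ 4) n n′
    (trans (recover-n n b) (trans (cong₂ (λ x z → - x ℤ.- + 2 ℤ.* z ℤ.- + 1) x≡ z≡) (sym (recover-n n′ b′))))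
    where
    recover-n : ∀ n b → + 4 ℤ.* n ≡ - (- (+ 2 ℤ.* (n ℤ.+ b)) ℤ.- + 1) ℤ.- + 2 ℤ.* (b ℤ.- n) ℤ.- + 1
    recover-n = ℤ-Solver.solve-∀
  b≡b′ : b ≡ b′
  b≡b′ = trans (recover-b n b) (trans (cong₂ ℤ._+_ z≡ n≡n′) (sym (recover-b n′ b′)))
    where
    recover-b : ∀ n b → b ≡ (b ℤ.- n) ℤ.+ n
    recover-b = ℤ-Solver.solve-∀

oddℤ-quadℤ-2 : ∀ x → oddℤ (quadℤ 2 x) ≡ oddℤ x
oddℤ-quadℤ-2 x = begin
  oddℤ (+ 7 ℤ.* (x ℤ.* x) ℤ.+ + 2 ℤ.* x)                  ≡⟨ oddℤ-+ (+ 7 ℤ.* (x ℤ.* x)) (+ 2 ℤ.* x) ⟩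
  oddℤ (+ 7 ℤ.* (x ℤ.* x)) xor oddℤ (+ 2 ℤ.* x)           ≡⟨ cong₂ _xor_ (trans (oddℤ-* (+ 7) (x ℤ.* x)) (oddℤ-* x x)) (oddℤ-* (+ 2) x) ⟩
  (oddℤ x ∧ oddℤ x) xor false                             ≡⟨ trans (xor-identityʳ _) (∧-idem (oddℤ x)) ⟩
  oddℤ x                                                  ∎
  where open ≡-Reasoning

oddℤ-w₁₂₄ℤ : ∀ x y z → oddℤ (w₁₂₄ℤ (x , y , z)) ≡ oddℤ x
oddℤ-w₁₂₄ℤ x y z = begin
  oddℤ (quadℤ 2 x ℤ.+ + 2 ℤ.* quadℤ 2 y ℤ.+ + 4 ℤ.* quadℤ 2 z)
    ≡⟨ oddℤ-+ (quadℤ 2 x ℤ.+ + 2 ℤ.* quadℤ 2 y) (+ 4 ℤ.* quadℤ 2 z) ⟩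
  oddℤ (quadℤ 2 x ℤ.+ + 2 ℤ.* quadℤ 2 y) xor oddℤ (+ 4 ℤ.* quadℤ 2 z)
    ≡⟨ cong₂ _xor_ (oddℤ-+ (quadℤ 2 x) (+ 2 ℤ.* quadℤ 2 y)) (oddℤ-* (+ 4) (quadℤ 2 z)) ⟩
  (oddℤ (quadℤ 2 x) xor oddℤ (+ 2 ℤ.* quadℤ 2 y)) xor false
    ≡⟨ cong (λ b → (b xor oddℤ (+ 2 ℤ.* quadℤ 2 y)) xor false) (oddℤ-quadℤ-2 x) ⟩
  (oddℤ x xor oddℤ (+ 2 ℤ.* quadℤ 2 y)) xor false
    ≡⟨ cong (λ b → (oddℤ x xor b) xor false) (oddℤ-* (+ 2) (quadℤ 2 y)) ⟩
  (oddℤ x xor false) xor false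
    ≡⟨ trans (xor-identityʳ _) (xor-identityʳ (oddℤ x)) ⟩
  oddℤ x
    ∎
  where open ≡-Reasoning

fℤ[2s+1] : ℤ → ℤ
fℤ[2s+1] s = quadℤ 2 (+ 2 ℤ.* s ℤ.+ + 1)

w₁₂₄ℤ≡8K+7⇒odd-y : ∀ K s {x} y z → x ≡ + 2 ℤ.* s ℤ.+ + 1 → w₁₂₄ℤ (x , y , z) ≡ + 8 ℤ.* K ℤ.+ + 7 → oddℤ y ≡ true
w₁₂₄ℤ≡8K+7⇒odd-y K s y z refl w≡ = trans (sym (oddℤ-quadℤ-2 y)) (trans (cong oddℤ quadℤ-y≡) (oddℤ-2*+1 V))
  where
  V : ℤ
  V = + 2 ℤ.* K ℤ.- + 7 ℤ.* (s ℤ.* s) ℤ.- + 8 ℤ.* s ℤ.- quadℤ 2 z ℤ.- + 1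
  isolate : ∀ A Y Z → + 2 ℤ.* Y ≡ (A ℤ.+ + 2 ℤ.* Y ℤ.+ + 4 ℤ.* Z) ℤ.- A ℤ.- + 4 ℤ.* Z
  isolate = ℤ-Solver.solve-∀
  expand : ∀ K s Z → (+ 8 ℤ.* K ℤ.+ + 7) ℤ.- (+ 7 ℤ.* ((+ 2 ℤ.* s ℤ.+ + 1) ℤ.* (+ 2 ℤ.* s ℤ.+ + 1)) ℤ.+ + 2 ℤ.* (+ 2 ℤ.* s ℤ.+ + 1)) ℤ.- + 4 ℤ.* Z
                   ≡ + 2 ℤ.* (+ 2 ℤ.* (+ 2 ℤ.* K ℤ.- + 7 ℤ.* (s ℤ.* s) ℤ.- + 8 ℤ.* s ℤ.- Z ℤ.- + 1) ℤ.+ + 1)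
  expand = ℤ-Solver.solve-∀
  quadℤ-y≡ : quadℤ 2 y ≡ + 2 ℤ.* V ℤ.+ + 1
  quadℤ-y≡ = ℤ.*-cancelˡ-≡ (+ 2) _ _
    (trans (isolate (fℤ[2s+1] s) (quadℤ 2 y) (quadℤ 2 z))
           (trans (cong (λ L → L ℤ.- fℤ[2s+1] s ℤ.- + 4 ℤ.* quadℤ 2 z) w≡) (expand K s (quadℤ 2 z))))

w₁₂₄ℤ≡8K+7⇒odd-s+z : ∀ K s t {x y} z → x ≡ + 2 ℤ.* s ℤ.+ + 1 → y ≡ + 2 ℤ.* t ℤ.+ + 1 →
                     w₁₂₄ℤ (x , y , z) ≡ + 8 ℤ.* K ℤ.+ + 7 → oddℤ (s ℤ.+ z) ≡ true
w₁₂₄ℤ≡8K+7⇒odd-s+z K s t z refl refl w≡ =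
  trans (oddℤ-+ s z) (trans (cong (oddℤ s xor_) oddℤ-z) (a-xor-a-xor-true (oddℤ s)))
  where
  W : ℤ
  W = K ℤ.- + 4 ℤ.* (s ℤ.* s) ℤ.- + 4 ℤ.* s ℤ.- + 7 ℤ.* (t ℤ.* t) ℤ.- + 8 ℤ.* t ℤ.- + 3
  isolate : ∀ A Y Z → + 4 ℤ.* Z ≡ (A ℤ.+ + 2 ℤ.* Y ℤ.+ + 4 ℤ.* Z) ℤ.- A ℤ.- + 2 ℤ.* Y
  isolate = ℤ-Solver.solve-∀
  expand : ∀ K s t → (+ 8 ℤ.* K ℤ.+ + 7)
                     ℤ.- (+ 7 ℤ.* ((+ 2 ℤ.* s ℤ.+ + 1) ℤ.* (+ 2 ℤ.* s ℤ.+ + 1)) ℤ.+ + 2 ℤ.* (+ 2 ℤ.* s ℤ.+ + 1))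
                     ℤ.- + 2 ℤ.* (+ 7 ℤ.* ((+ 2 ℤ.* t ℤ.+ + 1) ℤ.* (+ 2 ℤ.* t ℤ.+ + 1)) ℤ.+ + 2 ℤ.* (+ 2 ℤ.* t ℤ.+ + 1))
                   ≡ + 4 ℤ.* (+ 2 ℤ.* (K ℤ.- + 4 ℤ.* (s ℤ.* s) ℤ.- + 4 ℤ.* s ℤ.- + 7 ℤ.* (t ℤ.* t) ℤ.- + 8 ℤ.* t ℤ.- + 3)
                              ℤ.+ s ℤ.* s ℤ.+ + 1)
  expand = ℤ-Solver.solve-∀
  quadℤ-z≡ : quadℤ 2 z ≡ + 2 ℤ.* W ℤ.+ s ℤ.* s ℤ.+ + 1
  quadℤ-z≡ = ℤ.*-cancelˡ-≡ (+ 4) _ _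
    (trans (isolate (fℤ[2s+1] s) (fℤ[2s+1] t) (quadℤ 2 z))
           (trans (cong (λ L → L ℤ.- fℤ[2s+1] s ℤ.- + 2 ℤ.* fℤ[2s+1] t) w≡) (expand K s t)))
  oddℤ-z : oddℤ z ≡ oddℤ s xor true
  oddℤ-z = begin
    oddℤ z                                               ≡⟨ oddℤ-quadℤ-2 z ⟨
    oddℤ (quadℤ 2 z)                                     ≡⟨ cong oddℤ quadℤ-z≡ ⟩
    oddℤ (+ 2 ℤ.* W ℤ.+ s ℤ.* s ℤ.+ + 1)                 ≡⟨ oddℤ-+ (+ 2 ℤ.* W ℤ.+ s ℤ.* s) (+ 1) ⟩
    oddℤ (+ 2 ℤ.* W ℤ.+ s ℤ.* s) xor true                ≡⟨ cong (_xor true) (oddℤ-+ (+ 2 ℤ.* W) (s ℤ.* s)) ⟩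
    (oddℤ (+ 2 ℤ.* W) xor oddℤ (s ℤ.* s)) xor true       ≡⟨ cong₂ (λ a b → (a xor b) xor true) (oddℤ-* (+ 2) W) (oddℤ-* s s) ⟩
    (oddℤ s ∧ oddℤ s) xor true                           ≡⟨ cong (_xor true) (∧-idem (oddℤ s)) ⟩
    oddℤ s xor true                                      ∎
    where open ≡-Reasoning
  a-xor-a-xor-true : ∀ a → a xor (a xor true) ≡ true
  a-xor-a-xor-true false = refl
  a-xor-a-xor-true true  = refl

σ-onto : ∀ K x y z → w₁₂₄ℤ (x , y , z) ≡ + 8 ℤ.* K ℤ.+ + 7 → ∃ λ v → σ v ≡ (x , y , z)
σ-onto K x y z w≡ =
  let s , x≡2s+1   = oddℤ≡true⇒∃ x (trans (sym (oddℤ-w₁₂₄ℤ x y z)) (trans (cong oddℤ w≡) oddℤ-8K+7))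
      t , y≡2t+1   = oddℤ≡true⇒∃ y (w₁₂₄ℤ≡8K+7⇒odd-y K s y z x≡2s+1 w≡)
      w , s+z≡2w+1 = oddℤ≡true⇒∃ (s ℤ.+ z) (w₁₂₄ℤ≡8K+7⇒odd-s+z K s t z x≡2s+1 y≡2t+1 w≡)
  in (- w ℤ.- + 1 , - t ℤ.- + 1 , w ℤ.- s) ,
     cong₂ _,_ (trans (x≡ s w) (sym x≡2s+1)) (cong₂ _,_ (trans (y≡ t) (sym y≡2t+1)) (z≡ s z w s+z≡2w+1))
  where
  oddℤ-8K+7 : oddℤ (+ 8 ℤ.* K ℤ.+ + 7) ≡ true
  oddℤ-8K+7 = trans (oddℤ-+ (+ 8 ℤ.* K) (+ 7)) (cong (_xor true) (oddℤ-* (+ 8) K))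
  x≡ : ∀ s w → - (+ 2 ℤ.* ((- w ℤ.- + 1) ℤ.+ (w ℤ.- s))) ℤ.- + 1 ≡ + 2 ℤ.* s ℤ.+ + 1
  x≡ = ℤ-Solver.solve-∀
  y≡ : ∀ t → - (+ 2 ℤ.* (- t ℤ.- + 1)) ℤ.- + 1 ≡ + 2 ℤ.* t ℤ.+ + 1
  y≡ = ℤ-Solver.solve-∀
  z≡ : ∀ s z w → s ℤ.+ z ≡ + 2 ℤ.* w ℤ.+ + 1 → (w ℤ.- s) ℤ.- (- w ℤ.- + 1) ≡ z
  z≡ s z w s+z≡2w+1 = trans (regroup w s) (trans (cong (ℤ._- s) (sym s+z≡2w+1)) (cancel s z))
    where
    regroup : ∀ w s → (w ℤ.- s) ℤ.- (- w ℤ.- + 1) ≡ (+ 2 ℤ.* w ℤ.+ + 1) ℤ.- s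
    regroup = ℤ-Solver.solve-∀
    cancel : ∀ s z → (s ℤ.+ z) ℤ.- s ≡ z
    cancel = ℤ-Solver.solve-∀

∣∣≤w₁₂₄ : ∀ x y z → ∣ x ∣ ≤ w₁₂₄ (x , y , z) × ∣ y ∣ ≤ w₁₂₄ (x , y , z) × ∣ z ∣ ≤ w₁₂₄ (x , y , z)
∣∣≤w₁₂₄ x y z =
    ℕ.≤-trans (∣∣≤quad 1 4 x) (ℕ.m≤m+n (f x) _)
  , ℕ.≤-trans (∣∣≤quad 1 4 y) (ℕ.≤-trans (ℕ.m≤n*m (f y) 2) (ℕ.≤-trans (ℕ.m≤m+n (2 * f y) _) (ℕ.m≤n+m _ (f x))))
  , ℕ.≤-trans (∣∣≤quad 1 4 z) (ℕ.≤-trans (ℕ.m≤n*m (f z) 2) (ℕ.≤-trans (ℕ.m≤n*m (2 * f z) 2)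
      (ℕ.≤-trans (ℕ.m≤n+m _ (2 * f y)) (ℕ.m≤n+m _ (f x)))))

∣∣≤wₑ : ∀ n a b → ∣ n ∣ ≤ wₑ (n , a , b) × ∣ a ∣ ≤ wₑ (n , a , b) × ∣ b ∣ ≤ wₑ (n , a , b)
∣∣≤wₑ n a b =
    ℕ.≤-trans (∣∣≤quad 1 4 n) (ℕ.m≤m+n (f n) _)
  , ℕ.≤-trans (∣∣≤quad 5 0 a) (ℕ.≤-trans (ℕ.m≤m+n _ (quad 4 3 b)) (ℕ.≤-trans (ℕ.n≤1+n _) (ℕ.m≤n+m _ (f n))))
  , ℕ.≤-trans (∣∣≤quad 3 2 b) (ℕ.≤-trans (ℕ.m≤n+m _ (quad 6 1 a)) (ℕ.≤-trans (ℕ.n≤1+n _) (ℕ.m≤n+m _ (f n))))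

w₁₂₄∘σ : ∀ v → w₁₂₄ (σ v) ≡ 8 * wₑ v + 7
w₁₂₄∘σ v = ℤ.+-injective (begin
  + w₁₂₄ (σ v)              ≡⟨ +w₁₂₄ (σ v) ⟩
  w₁₂₄ℤ (σ v)               ≡⟨ w₁₂₄ℤ∘σ v ⟩
  + 8 ℤ.* wₑℤ v ℤ.+ + 7     ≡⟨ cong (λ r → + 8 ℤ.* r ℤ.+ + 7) (+wₑ v) ⟨
  + 8 ℤ.* + wₑ v ℤ.+ + 7    ≡⟨ cong (ℤ._+ + 7) (ℤ.pos-* 8 (wₑ v)) ⟨
  + (8 * wₑ v + 7)          ∎)
  where open ≡-Reasoning

count-w₁₂₄≡count-wₑ : ∀ K → count (range³ (8 * K + 7)) w₁₂₄ (8 * K + 7) ≡ count (range³ K) wₑ K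
count-w₁₂₄≡count-wₑ K =
  ⊕-reindex {_≟X_ = _≟³_} {_≟Y_ = _≟³_} (range³ N) (range³ K) φ ψ σ σ-injective sound onto covers-xs covers-ys
  where
  N = 8 * K + 7
  φ ψ : ℤ³ → Bool
  φ v = w₁₂₄ v ≡ᵇ N
  ψ v = wₑ v ≡ᵇ K
  sound : ∀ v → ψ v ≡ true → φ (σ v) ≡ true
  sound v ψv = ≡⇒≡ᵇ-true (trans (w₁₂₄∘σ v) (cong (λ r → 8 * r + 7) {wₑ v} {K} (≡ᵇ-true⇒≡ ψv)))
  onto : ∀ v → φ v ≡ true → ∃ λ u → ψ u ≡ true × σ u ≡ v
  onto v φv =
    let u , σu≡v = σ-onto (+ K) (proj₁ v) (proj₁ (proj₂ v)) (proj₂ (proj₂ v)) w₁₂₄ℤ≡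
        8wₑ+7≡N = trans (sym (w₁₂₄∘σ u)) (trans (cong w₁₂₄ σu≡v) (≡ᵇ-true⇒≡ φv))
    in u , ≡⇒≡ᵇ-true (ℕ.*-cancelˡ-≡ (wₑ u) K 8 (ℕ.+-cancelʳ-≡ 7 (8 * wₑ u) (8 * K) 8wₑ+7≡N)) , σu≡v
    where
    w₁₂₄ℤ≡ : w₁₂₄ℤ v ≡ + 8 ℤ.* + K ℤ.+ + 7
    w₁₂₄ℤ≡ = trans (sym (+w₁₂₄ v)) (trans (cong +_ (≡ᵇ-true⇒≡ φv)) (cong (ℤ._+ + 7) (ℤ.pos-* 8 K)))
  covers-xs : ∀ v → φ v ≡ true → occurs _≟³_ (range³ N) v ≡ true
  covers-xs (x , y , z) φv =
    let x≤ , y≤ , z≤ = ∣∣≤w₁₂₄ x y z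
        ≤N = λ {i} (i≤ : i ≤ w₁₂₄ (x , y , z)) → ℕ.≤-trans i≤ (ℕ.≤-reflexive (≡ᵇ-true⇒≡ φv))
    in occurs-range³ x y z (≤N x≤) (≤N y≤) (≤N z≤)
  covers-ys : ∀ v → ψ v ≡ true → occurs _≟³_ (range³ K) v ≡ true
  covers-ys (n , a , b) ψv =
    let n≤ , a≤ , b≤ = ∣∣≤wₑ n a b
        ≤K = λ {i} (i≤ : i ≤ wₑ (n , a , b)) → ℕ.≤-trans i≤ (ℕ.≤-reflexive (≡ᵇ-true⇒≡ ψv))
    in occurs-range³ n a b (≤K n≤) (≤K a≤) (≤K b≤)

F : Series
F = Ψ₂ 9 5

C : Series
C = c₂ 9 5

E : Series
E K = count (range² K) e K

F≗count : ∀ B → F ≗[≤ B ] count (range B) f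
F≗count B n n≤B = begin
  F n                              ≡⟨ Ψ₂≡count 9 5 n ⟩
  count (range n) (thetaExponent 9 5) n  ≡⟨ ⊕-cong (range n) (λ x → cong (ℕ._≡ᵇ n) (thetaExponent-9-5 x)) ⟩
  count (range n) f n              ≡⟨ count-range-mono f (∣∣≤quad 1 4) n≤B ⟨
  count (range B) f n              ∎
  where open ≡-Reasoning

E≗count : ∀ B → E ≗[≤ B ] count (range² B) e
E≗count B n n≤B = begin
  count (range² n) e n                                   ≡⟨ ⊕-cartesianProduct (range n) (range n) (λ p → e p ≡ᵇ n) ⟩
  ⊕ (range n) (λ a → count (range n) (e ∘ (a ,_)) n)     ≡⟨ ⊕-range-mono _ vanishes n≤B ⟨
  ⊕ (range B) (λ a → count (range n) (e ∘ (a ,_)) n)     ≡⟨ ⊕-cong (range B) (λ a → count-range-mono (e ∘ (a ,_)) (∣b∣≤e a) n≤B) ⟨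
  ⊕ (range B) (λ a → count (range B) (e ∘ (a ,_)) n)     ≡⟨ ⊕-cartesianProduct (range B) (range B) (λ p → e p ≡ᵇ n) ⟨
  count (range² B) e n                                   ∎
  where
  open ≡-Reasoning
  ∣a∣≤e : ∀ a b → ∣ a ∣ ≤ e (a , b)
  ∣a∣≤e a b = ℕ.≤-trans (∣∣≤quad 5 0 a) (ℕ.≤-trans (ℕ.m≤m+n _ (quad 4 3 b)) (ℕ.n≤1+n _))
  ∣b∣≤e : ∀ a b → ∣ b ∣ ≤ e (a , b)
  ∣b∣≤e a b = ℕ.≤-trans (∣∣≤quad 3 2 b) (ℕ.≤-trans (ℕ.m≤n+m _ (quad 6 1 a)) (ℕ.n≤1+n _))
  vanishes : ∀ a → n ℕ.< ∣ a ∣ → count (range n) (e ∘ (a ,_)) n ≡ false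
  vanishes a n<∣a∣ = trans (⊕-cong (range n) (λ b → dec-false (e (a , b) ℕ.≟ n)
                              (λ eab≡n → ℕ.<⇒≢ (ℕ.<-≤-trans n<∣a∣ (∣a∣≤e a b)) (sym eab≡n))))
                           (⊕-false (range n))

F₂ F₄ F₈ : Series
F₂ = dilate₂ F
F₄ = dilate₂ F₂
F₈ = dilate₂ F₄

F₂≗count : ∀ B → F₂ ≗[≤ B ] count (range B) (λ x → 2 * f x)
F₂≗count B k k≤B = trans (dilate₂-cong-≤ B (F≗count B) k k≤B) (dilate₂-count (range B) f k)

F₄≗count : ∀ B → F₄ ≗[≤ B ] count (range B) (λ x → 2 * (2 * f x))
F₄≗count B k k≤B = trans (dilate₂-cong-≤ B (F₂≗count B) k k≤B) (dilate₂-count (range B) (λ x → 2 * f x) k)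

F·E≡count-wₑ : ∀ K → (F · E) K ≡ count (range³ K) wₑ K
F·E≡count-wₑ K = trans (·-cong-≤ K (F≗count K) (E≗count K) K ℕ.≤-refl) (count-· (range K) (range² K) f e K)

F·F₂·F₄≡count-w₁₂₄ : ∀ N → (F · (F₂ · F₄)) N ≡ count (range³ N) w₁₂₄ N
F·F₂·F₄≡count-w₁₂₄ N = begin
  (F · (F₂ · F₄)) N
    ≡⟨ ·-cong-≤ N (F≗count N) F₂·F₄≗count N ℕ.≤-refl ⟩
  (count (range N) f · count (range² N) (λ (y , z) → 2 * f y + 2 * (2 * f z))) N
    ≡⟨ count-· (range N) (range² N) f (λ (y , z) → 2 * f y + 2 * (2 * f z)) N ⟩
  count (range³ N) w₁₂₄ N
    ∎
  where
  open ≡-Reasoning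
  F₂·F₄≗count : F₂ · F₄ ≗[≤ N ] count (range² N) (λ (y , z) → 2 * f y + 2 * (2 * f z))
  F₂·F₄≗count k k≤N = trans (·-cong-≤ N (F₂≗count N) (F₄≗count N) k k≤N)
                            (count-· (range N) (range N) (λ y → 2 * f y) (λ z → 2 * (2 * f z)) k)

F·C≗1 : F · C ≗ 1#
F·C≗1 = Ψ₂·c₂≗1 9 5 refl

C·F₈≗F·F₂·F₄ : C · F₈ ≗ F · (F₂ · F₄)
C·F₈≗F·F₂·F₄ n = begin
  (C · F₈) n                          ≡⟨ ·-congˡ F₈≗F·F·F₂·F₄ n ⟩
  (C · (F · (F · (F₂ · F₄)))) n       ≡⟨ ·-assoc C F (F · (F₂ · F₄)) n ⟨
  ((C · F) · (F · (F₂ · F₄))) n       ≡⟨ ·-congʳ (λ k → trans (·-comm C F k) (F·C≗1 k)) n ⟩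
  (1# · (F · (F₂ · F₄))) n            ≡⟨ ·-identityˡ (F · (F₂ · F₄)) n ⟩
  (F · (F₂ · F₄)) n                   ∎
  where
  open ≡-Reasoning
  F₈≗F·F·F₂·F₄ : F₈ ≗ F · (F · (F₂ · F₄))
  F₈≗F·F·F₂·F₄ k = sym (begin
    (F · (F · (F₂ · F₄))) k   ≡⟨ ·-square F (F₂ · F₄) k ⟩
    (F₂ · (F₂ · F₄)) k        ≡⟨ ·-square F₂ F₄ k ⟩
    (F₄ · F₄) k               ≡⟨ ·-self F₄ k ⟩
    F₈ k                      ∎)

C₇ : Series
C₇ = oddPart (oddPart (oddPart C))

1+2[1+2[1+2K]]≡8K+7 : ∀ K → suc (2 * suc (2 * suc (2 * K))) ≡ 8 * K + 7
1+2[1+2[1+2K]]≡8K+7 = solve-∀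

C₇≡C[8K+7] : ∀ K → C₇ K ≡ C (8 * K + 7)
C₇≡C[8K+7] K = trans (oddPart-spec (oddPart (oddPart C)) K)
  (trans (oddPart-spec (oddPart C) (suc (2 * K)))
  (trans (oddPart-spec C (suc (2 * suc (2 * K)))) (cong C (1+2[1+2[1+2K]]≡8K+7 K))))

C₇·F≗E·F : C₇ · F ≗ E · F
C₇·F≗E·F K = begin
  (C₇ · F) K                                   ≡⟨ ·-dilate₂-odd (oddPart (oddPart C)) F K ⟨
  (oddPart (oddPart C) · F₂) (suc (2 * K))     ≡⟨ ·-dilate₂-odd (oddPart C) F₂ (suc (2 * K)) ⟨
  (oddPart C · F₄) (suc (2 * suc (2 * K)))     ≡⟨ ·-dilate₂-odd C F₄ (suc (2 * suc (2 * K))) ⟨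
  (C · F₈) (suc (2 * suc (2 * suc (2 * K))))   ≡⟨ C·F₈≗F·F₂·F₄ (suc (2 * suc (2 * suc (2 * K)))) ⟩
  (F · (F₂ · F₄)) (suc (2 * suc (2 * suc (2 * K))))  ≡⟨ cong (F · (F₂ · F₄)) (1+2[1+2[1+2K]]≡8K+7 K) ⟩
  (F · (F₂ · F₄)) (8 * K + 7)                  ≡⟨ F·F₂·F₄≡count-w₁₂₄ (8 * K + 7) ⟩
  count (range³ (8 * K + 7)) w₁₂₄ (8 * K + 7)   ≡⟨ count-w₁₂₄≡count-wₑ K ⟩
  count (range³ K) wₑ K                       ≡⟨ F·E≡count-wₑ K ⟨
  (F · E) K                                    ≡⟨ ·-comm F E K ⟩
  (E · F) K                                    ∎
  where open ≡-Reasoning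

C[8K+7]≡E : ∀ K → C (8 * K + 7) ≡ E K
C[8K+7]≡E K = trans (sym (C₇≡C[8K+7] K)) (·-cancelʳ F·C≗1 C₇·F≗E·F K)

+∣i∣*∣i∣ : ∀ i → + (∣ i ∣ * ∣ i ∣) ≡ i ℤ.* i
+∣i∣*∣i∣ (+ n)    = ℤ.pos-* n n
+∣i∣*∣i∣ -[1+ n ] = refl

E≡true⇒sum-of-two-squares : ∀ K → E K ≡ true → ∃ λ X → ∃ λ Y → X * X + Y * Y ≡ 7 * K + 6
E≡true⇒sum-of-two-squares K EK with ⊕≡true⇒∃ (range² K) (λ p → e p ≡ᵇ K) EK
... | (a , b) , e≡K = ∣ + 7 ℤ.* a ℤ.+ + 3 ∣ , ∣ + 7 ℤ.* b ℤ.+ + 2 ∣ , ℤ.+-injective (begin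
  + (∣ A ∣ * ∣ A ∣ + ∣ B ∣ * ∣ B ∣)              ≡⟨ cong₂ ℤ._+_ (+∣i∣*∣i∣ A) (+∣i∣*∣i∣ B) ⟩
  A ℤ.* A ℤ.+ B ℤ.* B                           ≡⟨ identity a b ⟩
  + 7 ℤ.* (+ 1 ℤ.+ (quadℤ 6 a ℤ.+ quadℤ 4 b)) ℤ.+ + 6
    ≡⟨ cong (λ r → + 7 ℤ.* (+ 1 ℤ.+ r) ℤ.+ + 6) (sym (cong₂ ℤ._+_ (+quad 6 1 refl a) (+quad 4 3 refl b))) ⟩
  + 7 ℤ.* + e (a , b) ℤ.+ + 6                   ≡⟨ cong (λ r → + 7 ℤ.* + r ℤ.+ + 6) {e (a , b)} {K} (≡ᵇ-true⇒≡ e≡K) ⟩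
  + 7 ℤ.* + K ℤ.+ + 6                           ≡⟨ cong (ℤ._+ + 6) (ℤ.pos-* 7 K) ⟨
  + (7 * K + 6)                                 ∎)
  where
  open ≡-Reasoning
  A B : ℤ
  A = + 7 ℤ.* a ℤ.+ + 3
  B = + 7 ℤ.* b ℤ.+ + 2
  identity : ∀ a b → (+ 7 ℤ.* a ℤ.+ + 3) ℤ.* (+ 7 ℤ.* a ℤ.+ + 3) ℤ.+ (+ 7 ℤ.* b ℤ.+ + 2) ℤ.* (+ 7 ℤ.* b ℤ.+ + 2)
                   ≡ + 7 ℤ.* (+ 1 ℤ.+ ((+ 7 ℤ.* (a ℤ.* a) ℤ.+ + 6 ℤ.* a) ℤ.+ (+ 7 ℤ.* (b ℤ.* b) ℤ.+ + 4 ℤ.* b))) ℤ.+ + 6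
  identity = ℤ-Solver.solve-∀

-- Sums of two squares and primes p ≡ 3 (mod 4)

^ˢ≡^ : ∀ x n → x SemiringExp.^ n ≡ x ^ n
^ˢ≡^ x zero    = refl
^ˢ≡^ x (suc n) = cong (x *_) (^ˢ≡^ x n)

×≡* : ∀ n x → n SemiringMult.× x ≡ n * x
×≡* zero    x = refl
×≡* (suc n) x = cong (λ m → x + m) (×≡* n x)

∣-sum : ∀ {d} n (f : Fin n → ℕ) → (∀ i → d ∣ℕ f i) → d ∣ℕ ∑ f
∣-sum zero    f d∣f = divides 0 refl
∣-sum (suc n) f d∣f = ∣m∣n⇒∣m+n (d∣f Fin.zero) (∣-sum n (f ∘ Fin.suc) (d∣f ∘ Fin.suc))

C*k!*[n∸k]!≡n! : ∀ {n k} → k ≤ n → (n choose k) * (k ! * (n ∸ k) !) ≡ n !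
C*k!*[n∸k]!≡n! {n} {k} k≤n = trans (cong (_* (k ! * (n ∸ k) !)) (nCk≡n!/k![n-k]! k≤n)) (m/n*n≡m (k![n∸k]!∣n! k≤n))
  where instance
  k!*[n∸k]!≢0 : NonZero (k ! * (n ∸ k) !)
  k!*[n∸k]!≢0 = k ℕ.!* (n ∸ k) !≢0

n∣n! : ∀ n .{{_ : NonZero n}} → n ∣ℕ n !
n∣n! (suc n) = m∣m*n (n !)

module _ {p} (p-prime : Prime p) where

  private instance
    p≢0 : NonZero p
    p≢0 = prime⇒nonZero p-prime

  prime∤1 : ¬ p ∣ℕ 1
  prime∤1 p∣1 = ℕ.<⇒≱ (ℕ.nonTrivial⇒n>1 p {{prime⇒nonTrivial p-prime}}) (∣⇒≤ p∣1)

  prime∣^⇒∣ : ∀ m j → p ∣ℕ m ^ j → p ∣ℕ m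
  prime∣^⇒∣ m zero    p∣1 = ⊥-elim (prime∤1 p∣1)
  prime∣^⇒∣ m (suc j) p∣m^j with euclidsLemma m (m ^ j) p-prime p∣m^j
  ... | inj₁ p∣m   = p∣m
  ... | inj₂ p∣m^j = prime∣^⇒∣ m j p∣m^j

  prime∤m! : ∀ m → m < p → ¬ p ∣ℕ m !
  prime∤m! zero    _   p∣1 = prime∤1 p∣1
  prime∤m! (suc m) m<p p∣m! with euclidsLemma (suc m) (m !) p-prime p∣m!
  ... | inj₁ p∣1+m = ℕ.<-irrefl refl (ℕ.≤-<-trans (∣⇒≤ p∣1+m) m<p)
  ... | inj₂ p∣m!  = prime∤m! m (ℕ.<-trans (ℕ.n<1+n m) m<p) p∣m!

  prime∣C : ∀ {k} → 0 < k → k < p → p ∣ℕ p choose k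
  prime∣C {k} 0<k k<p
    with euclidsLemma (p choose k) (k ! * (p ∸ k) !) p-prime (subst (p ∣ℕ_) (sym (C*k!*[n∸k]!≡n! (ℕ.<⇒≤ k<p))) (n∣n! p))
  ... | inj₁ p∣C = p∣C
  ... | inj₂ p∣k!*[p-k]! with euclidsLemma (k !) ((p ∸ k) !) p-prime p∣k!*[p-k]!
  ...   | inj₁ p∣k!     = ⊥-elim (prime∤m! k k<p p∣k!)
  ...   | inj₂ p∣[p-k]! = ⊥-elim (prime∤m! (p ∸ k) (ℕ.∸-monoʳ-< 0<k (ℕ.<⇒≤ k<p)) p∣[p-k]!)

freshman : ∀ {p} → Prime p → ∀ x y → ∃ λ r → (x + y) ^ p ≡ x ^ p + y ^ p + r * p
freshman {suc p′} p-prime x y with ∣-sum p′ middle p∣middle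
  where
  middle : Fin p′ → ℕ
  middle i = binomialTerm x y (suc p′) (Fin.suc (inject₁ i))
  p∣middle : ∀ i → suc p′ ∣ℕ middle i
  p∣middle i =
    subst (suc p′ ∣ℕ_) (sym (×≡* (suc p′ choose suc (toℕ (inject₁ i))) (binomial x y (suc p′) (Fin.suc (inject₁ i)))))
      (∣m⇒∣m*n (binomial x y (suc p′) (Fin.suc (inject₁ i)))
        (subst (λ j → suc p′ ∣ℕ suc p′ choose suc j) (sym (toℕ-inject₁ i)) (prime∣C p-prime (s≤s z≤n) (s≤s (toℕ<n i)))))
... | divides r middle≡r*p = r , (begin
  (x + y) ^ P                                     ≡⟨ ^ˢ≡^ (x + y) P ⟨
  (x + y) SemiringExp.^ P                         ≡⟨ binomial-theorem P x y ⟩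
  term Fin.zero + ∑ (term ∘ Fin.suc)            ≡⟨ cong (λ m → term Fin.zero + m) (sum-init-last (term ∘ Fin.suc)) ⟩
  term Fin.zero + (∑ (init (term ∘ Fin.suc)) + term (Fin.suc (fromℕ p′)))
    ≡⟨ cong₂ (λ a b → a + (b + term (Fin.suc (fromℕ p′)))) first middle≡r*p ⟩
  y ^ P + (r * P + term (Fin.suc (fromℕ p′)))     ≡⟨ cong (λ a → y ^ P + (r * P + a)) final ⟩
  y ^ P + (r * P + x ^ P)                         ≡⟨ rearrange (x ^ P) (y ^ P) (r * P) ⟩
  x ^ P + y ^ P + r * P                           ∎)
  where
  open ≡-Reasoning
  P : ℕ
  P = suc p′
  term : Fin (suc P) → ℕ
  term = binomialTerm x y P
  first : term Fin.zero ≡ y ^ P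
  first = trans (×≡* (P choose 0) (1 * y SemiringExp.^ P))
                (trans (cong (_* (1 * y SemiringExp.^ P)) (trans (nCk≡nC[n∸k] {0} {P} z≤n) (nCn≡1 P)))
                       (trans (ℕ.*-identityˡ (1 * y SemiringExp.^ P)) (trans (ℕ.*-identityˡ (y SemiringExp.^ P)) (^ˢ≡^ y P))))
  final : term (Fin.suc (fromℕ p′)) ≡ x ^ P
  final = begin
    term (Fin.suc (fromℕ p′))
      ≡⟨ cong (λ j → (P choose j) SemiringMult.× (x SemiringExp.^ j * y SemiringExp.^ (P ∸ j))) (cong suc (toℕ-fromℕ p′)) ⟩
    (P choose P) SemiringMult.× (x SemiringExp.^ P * y SemiringExp.^ (P ∸ P))   ≡⟨ ×≡* (P choose P) _ ⟩
    (P choose P) * (x SemiringExp.^ P * y SemiringExp.^ (P ∸ P))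
      ≡⟨ cong₂ (λ a n → a * (x SemiringExp.^ P * y SemiringExp.^ n)) (nCn≡1 P) (ℕ.n∸n≡0 P) ⟩
    1 * (x SemiringExp.^ P * 1)                              ≡⟨ trans (ℕ.*-identityˡ _) (ℕ.*-identityʳ _) ⟩
    x SemiringExp.^ P                                        ≡⟨ ^ˢ≡^ x P ⟩
    x ^ P                                                    ∎
  rearrange : ∀ a b c → b + (c + a) ≡ a + b + c
  rearrange = solve-∀

fermat : ∀ {p} → Prime p → ∀ a → ∃ λ q → a ^ p ≡ a + q * p
fermat {suc p′} p-prime zero    = 0 , refl
fermat {suc p′} p-prime (suc a) with fermat p-prime a | freshman p-prime a 1
... | q , a^p≡a+qp | r , [a+1]^p≡a^p+1^p+rp = q + r , (begin
  suc a ^ P                      ≡⟨ cong (_^ P) (ℕ.+-comm 1 a) ⟩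
  (a + 1) ^ P                    ≡⟨ [a+1]^p≡a^p+1^p+rp ⟩
  a ^ P + 1 ^ P + r * P          ≡⟨ cong₂ (λ b c → b + c + r * P) a^p≡a+qp (ℕ.^-zeroˡ P) ⟩
  a + q * P + 1 + r * P          ≡⟨ rearrange a q r P ⟩
  suc a + (q + r) * P            ∎)
  where
  open ≡-Reasoning
  P : ℕ
  P = suc p′
  rearrange : ∀ a q r P → a + q * P + 1 + r * P ≡ suc a + (q + r) * P
  rearrange = solve-∀

fermat-unit : ∀ {p a} → Prime p → ¬ p ∣ℕ a → ∃ λ r → a ^ (p ∸ 1) ≡ 1 + r * p
fermat-unit {suc p′} {a} p-prime p∤a with fermat p-prime a
... | q , a^p≡a+qp with euclidsLemma a (a ^ p′ ∸ 1) p-prime (divides q a*[a^p′∸1]≡q*p)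
  where
  a*[a^p′∸1]≡q*p : a * (a ^ p′ ∸ 1) ≡ q * suc p′
  a*[a^p′∸1]≡q*p = begin
    a * (a ^ p′ ∸ 1)       ≡⟨ ℕ.*-distribˡ-∸ a (a ^ p′) 1 ⟩
    a ^ suc p′ ∸ a * 1     ≡⟨ cong₂ _∸_ a^p≡a+qp (ℕ.*-identityʳ a) ⟩
    a + q * suc p′ ∸ a     ≡⟨ ℕ.m+n∸m≡n a (q * suc p′) ⟩
    q * suc p′             ∎
    where open ≡-Reasoning
... | inj₁ p∣a                = ⊥-elim (p∤a p∣a)
... | inj₂ (divides r a^p′∸1≡rp) = r , trans (sym (ℕ.m+[n∸m]≡n 1≤a^p′)) (cong (λ m → 1 + m) a^p′∸1≡rp)
  where
  instance
    a≢0 : NonZero a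
    a≢0 = ℕ.≢-nonZero (λ a≡0 → p∤a (subst (suc p′ ∣ℕ_) (sym a≡0) (divides 0 refl)))
  1≤a^p′ : 1 ≤ a ^ p′
  1≤a^p′ = ℕ.m^n>0 a p′

a+b∣a^odd+b^odd : ∀ t a b → a + b ∣ℕ a ^ suc (2 * t) + b ^ suc (2 * t)
a+b∣a^odd+b^odd zero    a b = divides 1 (identity a b)
  where
  identity : ∀ a b → a * 1 + b * 1 ≡ 1 * (a + b)
  identity = solve-∀
a+b∣a^odd+b^odd (suc t) a b = subst (λ k → a + b ∣ℕ a ^ suc k + b ^ suc k) (sym (ℕ.*-suc 2 t))
  (∣m+n∣m⇒∣n (divides (a * A + b * B) (identity a b A B)) (∣n⇒∣m*n (a * b) (a+b∣a^odd+b^odd t a b)))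
  where
  A B : ℕ
  A = a ^ suc (2 * t)
  B = b ^ suc (2 * t)
  identity : ∀ a b A B → a * b * (A + B) + (a * (a * A) + b * (b * B)) ≡ (a * A + b * B) * (a + b)
  identity = solve-∀

module _ {p} (p-prime : Prime p) (p%4≡3 : p % 4 ≡ 3) where

  private
    t : ℕ
    t = p / 4
    p≡3+4t : p ≡ 3 + t * 4
    p≡3+4t = trans (m≡m%n+[m/n]*n p 4) (cong (_+ t * 4) p%4≡3)

  -- If p ∤ x then p ∤ y, and for the odd h = (p-1)/2 Fermat gives (x²)^h + (y²)^h ≡ 2 (mod p),
  -- while x² + y² divides (x²)^h + (y²)^h; so p ∣ 2.
  prime∣x²+y²⇒∣x : ∀ x y → p ∣ℕ x * x + y * y → p ∣ℕ x
  prime∣x²+y²⇒∣x x y p∣x²+y² with p ∣? x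
  ... | yes p∣x = p∣x
  ... | no  p∤x = ⊥-elim (p∤2 (∣m+n∣m⇒∣n (subst (p ∣ℕ_) sum≡ p∣sum) (divides (r₁ + r₂) refl)))
    where
    p∤2 : ¬ p ∣ℕ 2
    p∤2 p∣2 = ℕ.<⇒≱ (subst (3 ≤_) (sym p≡3+4t) (ℕ.m≤m+n 3 (t * 4))) (∣⇒≤ p∣2)
    p∤y : ¬ p ∣ℕ y
    p∤y p∣y with euclidsLemma x x p-prime (∣m+n∣m⇒∣n (subst (p ∣ℕ_) (ℕ.+-comm (x * x) (y * y)) p∣x²+y²) (∣m⇒∣m*n y p∣y))
    ... | inj₁ p∣x = p∤x p∣x
    ... | inj₂ p∣x = p∤x p∣x
    h : ℕ
    h = suc (2 * t)
    p∸1≡2h : p ∸ 1 ≡ 2 * h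
    p∸1≡2h = trans (cong (_∸ 1) p≡3+4t) (lemma t)
      where
      lemma : ∀ t → 2 + t * 4 ≡ 2 * suc (2 * t)
      lemma = solve-∀
    square^h : ∀ z → (z * z) ^ h ≡ z ^ (p ∸ 1)
    square^h z = trans (cong (λ w → (z * w) ^ h) (sym (ℕ.*-identityʳ z))) (trans (ℕ.^-*-assoc z 2 h) (cong (z ^_) (sym p∸1≡2h)))
    r₁ r₂ : ℕ
    r₁ = proj₁ (fermat-unit p-prime p∤x)
    r₂ = proj₁ (fermat-unit p-prime p∤y)
    sum≡ : (x * x) ^ h + (y * y) ^ h ≡ (r₁ + r₂) * p + 2
    sum≡ = begin
      (x * x) ^ h + (y * y) ^ h         ≡⟨ cong₂ _+_ (square^h x) (square^h y) ⟩
      x ^ (p ∸ 1) + y ^ (p ∸ 1)         ≡⟨ cong₂ _+_ (proj₂ (fermat-unit p-prime p∤x)) (proj₂ (fermat-unit p-prime p∤y)) ⟩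
      1 + r₁ * p + (1 + r₂ * p)         ≡⟨ lemma r₁ r₂ p ⟩
      (r₁ + r₂) * p + 2                 ∎
      where
      open ≡-Reasoning
      lemma : ∀ r₁ r₂ p → 1 + r₁ * p + (1 + r₂ * p) ≡ (r₁ + r₂) * p + 2
      lemma = solve-∀
    p∣sum : p ∣ℕ (x * x) ^ h + (y * y) ^ h
    p∣sum = ∣-trans p∣x²+y² (a+b∣a^odd+b^odd t (x * x) (y * y))

module _ {p} (p-prime : Prime p) (p∣x²+y²⇒p∣x : ∀ x y → p ∣ℕ x * x + y * y → p ∣ℕ x) where

  private instance
    p≢0 : NonZero p
    p≢0 = prime⇒nonZero p-prime

  p²∣x²+y² : ∀ x y → p ∣ℕ x * x + y * y → ∃ λ S → x * x + y * y ≡ S * (p * p) × ∃ λ x′ → ∃ λ y′ → S ≡ x′ * x′ + y′ * y′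
  p²∣x²+y² x y p∣x²+y² with p∣x²+y²⇒p∣x x y p∣x²+y² | p∣x²+y²⇒p∣x y x (subst (p ∣ℕ_) (ℕ.+-comm (x * x) (y * y)) p∣x²+y²)
  ... | divides x′ x≡x′p | divides y′ y≡y′p =
    x′ * x′ + y′ * y′ , trans (cong₂ (λ a b → a * a + b * b) x≡x′p y≡y′p) (lemma x′ y′ p) , x′ , y′ , refl
    where
    lemma : ∀ x y p → x * p * (x * p) + y * p * (y * p) ≡ (x * x + y * y) * (p * p)
    lemma = solve-∀

  x²+y²≢p^odd*u : ∀ m x y u → ¬ p ∣ℕ u → x * x + y * y ≢ p ^ (2 * m + 1) * u
  x²+y²≢p^odd*u m x y u p∤u x²+y²≡ with p²∣x²+y² x y (subst (p ∣ℕ_) (sym x²+y²≡) (∣m⇒∣m*n u p∣p^[2m+1]))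
    where
    p∣p^[2m+1] : p ∣ℕ p ^ (2 * m + 1)
    p∣p^[2m+1] = divides (p ^ (2 * m)) (trans (cong (p ^_) (ℕ.+-comm (2 * m) 1)) (ℕ.*-comm p (p ^ (2 * m))))
  x²+y²≢p^odd*u zero    x y u p∤u x²+y²≡ | S , x²+y²≡Sp² , _ =
    p∤u (divides S (ℕ.*-cancelˡ-≡ u (S * p) p (begin
      p * u             ≡⟨ cong (_* u) (ℕ.*-identityʳ p) ⟨
      p * 1 * u         ≡⟨ trans (sym x²+y²≡) x²+y²≡Sp² ⟩
      S * (p * p)       ≡⟨ lemma S p ⟩
      p * (S * p)       ∎)))
    where
    open ≡-Reasoning
    lemma : ∀ S p → S * (p * p) ≡ p * (S * p)
    lemma = solve-∀
  x²+y²≢p^odd*u (suc m) x y u p∤u x²+y²≡ | S , x²+y²≡Sp² , x′ , y′ , refl =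
    x²+y²≢p^odd*u m x′ y′ u p∤u (ℕ.*-cancelʳ-≡ S (p ^ (2 * m + 1) * u) (p * p) {{ℕ.m*n≢0 p p}} (begin
      S * (p * p)                       ≡⟨ trans (sym x²+y²≡Sp²) x²+y²≡ ⟩
      p ^ (2 * suc m + 1) * u           ≡⟨ cong (λ k → p ^ k * u) (exponent m) ⟩
      p * (p * p ^ (2 * m + 1)) * u     ≡⟨ lemma p (p ^ (2 * m + 1)) u ⟩
      p ^ (2 * m + 1) * u * (p * p)     ∎))
    where
    open ≡-Reasoning
    exponent : ∀ m → 2 * suc m + 1 ≡ 2 + (2 * m + 1)
    exponent = solve-∀
    lemma : ∀ p P u → p * (p * P) * u ≡ P * u * (p * p)
    lemma = solve-∀
-- The index of the theorem

7b+1^j≡7d+1 : ∀ b j → ∃ λ d → (7 * b + 1) ^ j ≡ 7 * d + 1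
7b+1^j≡7d+1 b zero    = 0 , refl
7b+1^j≡7d+1 b (suc j) with 7b+1^j≡7d+1 b j
... | d , eq = 7 * b * d + b + d , trans (cong ((7 * b + 1) *_) eq) (lemma b d)
  where
  lemma : ∀ b d → (7 * b + 1) * (7 * d + 1) ≡ 7 * (7 * b * d + b + d) + 1
  lemma = solve-∀

p%28≡15∨27⇒p%4≡3 : ∀ p → p % 28 ≡ 15 ⊎ p % 28 ≡ 27 → p % 4 ≡ 3
p%28≡15∨27⇒p%4≡3 p p%28 = trans (sym (m∣n⇒o%n%m≡o%m 4 28 p (divides 7 refl))) (r%4≡3 p%28)
  where
  r%4≡3 : p % 28 ≡ 15 ⊎ p % 28 ≡ 27 → p % 28 % 4 ≡ 3
  r%4≡3 (inj₁ p%28≡15) = cong (_% 4) p%28≡15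
  r%4≡3 (inj₂ p%28≡27) = cong (_% 4) p%28≡27

p%28≡15∨27⇒p²≡1[7] : ∀ p → p % 28 ≡ 15 ⊎ p % 28 ≡ 27 → ∃ λ b → p * p ≡ 7 * b + 1
p%28≡15∨27⇒p²≡1[7] p (inj₁ p%28≡15) = 32 + 120 * q + 112 * (q * q) , (begin
  p * p                            ≡⟨ cong₂ _*_ p≡ p≡ ⟩
  (15 + q * 28) * (15 + q * 28)    ≡⟨ lemma q ⟩
  7 * (32 + 120 * q + 112 * (q * q)) + 1 ∎)
  where
  open ≡-Reasoning
  q : ℕ
  q = p / 28
  p≡ : p ≡ 15 + q * 28
  p≡ = trans (m≡m%n+[m/n]*n p 28) (cong (_+ q * 28) p%28≡15)
  lemma : ∀ q → (15 + q * 28) * (15 + q * 28) ≡ 7 * (32 + 120 * q + 112 * (q * q)) + 1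
  lemma = solve-∀
p%28≡15∨27⇒p²≡1[7] p (inj₂ p%28≡27) = 104 + 216 * q + 112 * (q * q) , (begin
  p * p                            ≡⟨ cong₂ _*_ p≡ p≡ ⟩
  (27 + q * 28) * (27 + q * 28)    ≡⟨ lemma q ⟩
  7 * (104 + 216 * q + 112 * (q * q)) + 1 ∎)
  where
  open ≡-Reasoning
  q : ℕ
  q = p / 28
  p≡ : p ≡ 27 + q * 28
  p≡ = trans (m≡m%n+[m/n]*n p 28) (cong (_+ q * 28) p%28≡27)
  lemma : ∀ q → (27 + q * 28) * (27 + q * 28) ≡ 7 * (104 + 216 * q + 112 * (q * q)) + 1
  lemma = solve-∀

p%28≡15∨27⇒8<p : ∀ p → p % 28 ≡ 15 ⊎ p % 28 ≡ 27 → 8 ℕ.< p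
p%28≡15∨27⇒8<p p p%28 = ℕ.≤-trans (8<r p%28) (ℕ.≤-trans (ℕ.m≤m+n (p % 28) (p / 28 * 28)) (ℕ.≤-reflexive (sym (m≡m%n+[m/n]*n p 28))))
  where
  8<r : p % 28 ≡ 15 ⊎ p % 28 ≡ 27 → 8 ℕ.< p % 28
  8<r (inj₁ p%28≡15) = subst (8 ℕ.<_) (sym p%28≡15) (ℕ.m≤n+m 9 6)
  8<r (inj₂ p%28≡27) = subst (8 ℕ.<_) (sym p%28≡27) (ℕ.m≤n+m 9 18)

2^[3k+j]≡8^k*2^j : ∀ k j → 2 ^ (3 * k + j) ≡ 8 ^ k * 2 ^ j
2^[3k+j]≡8^k*2^j k j = trans (ℕ.^-distribˡ-+-* 2 (3 * k) j) (cong (_* 2 ^ j) (sym (ℕ.^-*-assoc 2 3 k)))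

p^[2m+2]≡p^[2m+1]*p : ∀ p m → p ^ (2 * m + 2) ≡ p ^ (2 * m + 1) * p
p^[2m+2]≡p^[2m+1]*p p m = trans (cong (p ^_) (exponent m)) (ℕ.*-comm p (p ^ (2 * m + 1)))
  where
  exponent : ∀ m → 2 * m + 2 ≡ suc (2 * m + 1)
  exponent = solve-∀

p^[2m+2]≡1[7] : ∀ p b m → p * p ≡ 7 * b + 1 → ∃ λ d → p ^ (2 * m + 2) ≡ 7 * d + 1
p^[2m+2]≡1[7] p b m p²≡7b+1 with 7b+1^j≡7d+1 b (suc m)
... | d , [7b+1]^[m+1]≡7d+1 = d , (begin
  p ^ (2 * m + 2)          ≡⟨ cong (p ^_) (exponent m) ⟩
  p ^ (2 * suc m)          ≡⟨ ℕ.^-*-assoc p 2 (suc m) ⟨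
  (p ^ 2) ^ suc m          ≡⟨ cong (λ q → (p * q) ^ suc m) (ℕ.*-identityʳ p) ⟩
  (p * p) ^ suc m          ≡⟨ cong (_^ suc m) p²≡7b+1 ⟩
  (7 * b + 1) ^ suc m      ≡⟨ [7b+1]^[m+1]≡7d+1 ⟩
  7 * d + 1                ∎)
  where
  open ≡-Reasoning
  exponent : ∀ m → 2 * m + 2 ≡ 2 * suc m
  exponent = solve-∀

index≡8K+7 : ∀ p m n k a d → 8 ^ k ≡ 7 * a + 1 → p ^ (2 * m + 2) ≡ 7 * d + 1 →
  2 ^ (3 * k + 3) * p ^ (2 * m + 1) * n + (3 * 2 ^ (3 * k + 4) * p ^ (2 * m + 2) + 1) / 7
    ≡ 8 * (8 ^ k * p ^ (2 * m + 1) * n + 6 * (7 * a * d + a + d)) + 7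
index≡8K+7 p m n k a d 8^k≡7a+1 p^[2m+2]≡7d+1 = begin
  2 ^ (3 * k + 3) * P * n + (3 * 2 ^ (3 * k + 4) * p ^ (2 * m + 2) + 1) / 7
    ≡⟨ cong₂ (λ x y → x * P * n + y) (2^[3k+j]≡8^k*2^j k 3) (trans (cong (_/ 7) numerator≡) (m*n/n≡m (48 * s + 7) 7)) ⟩
  8 ^ k * 8 * P * n + (48 * s + 7)
    ≡⟨ regroup (8 ^ k) P n s ⟩
  8 * (8 ^ k * P * n + 6 * s) + 7
    ∎
  where
  open ≡-Reasoning
  P s : ℕ
  P = p ^ (2 * m + 1)
  s = 7 * a * d + a + d
  numerator : ∀ a d → 3 * ((7 * a + 1) * 16) * (7 * d + 1) + 1 ≡ (48 * (7 * a * d + a + d) + 7) * 7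
  numerator = solve-∀
  numerator≡ : 3 * 2 ^ (3 * k + 4) * p ^ (2 * m + 2) + 1 ≡ (48 * s + 7) * 7
  numerator≡ = trans (cong₂ (λ x y → 3 * x * y + 1) (trans (2^[3k+j]≡8^k*2^j k 4) (cong (_* 16) 8^k≡7a+1)) p^[2m+2]≡7d+1)
                     (numerator a d)
  regroup : ∀ u P n s → u * 8 * P * n + (48 * s + 7) ≡ 8 * (u * P * n + 6 * s) + 7
  regroup = solve-∀

7K+6≡p^[2m+1]*u : ∀ p m n k a d → 8 ^ k ≡ 7 * a + 1 → p ^ (2 * m + 2) ≡ 7 * d + 1 →
  7 * (8 ^ k * p ^ (2 * m + 1) * n + 6 * (7 * a * d + a + d)) + 6 ≡ p ^ (2 * m + 1) * (8 ^ k * (7 * n + 6 * p))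
7K+6≡p^[2m+1]*u p m n k a d 8^k≡7a+1 p^[2m+2]≡7d+1 = begin
  7 * (u * P * n + 6 * s) + 6                         ≡⟨ expand u P n s ⟩
  7 * (u * P * n) + 6 * (7 * s + 1)                   ≡⟨ cong (λ x → 7 * (u * P * n) + 6 * x) (product a d) ⟨
  7 * (u * P * n) + 6 * ((7 * a + 1) * (7 * d + 1))
    ≡⟨ cong₂ (λ x y → 7 * (u * P * n) + 6 * (x * y)) (sym 8^k≡7a+1) (trans (sym p^[2m+2]≡7d+1) (p^[2m+2]≡p^[2m+1]*p p m)) ⟩
  7 * (u * P * n) + 6 * (u * (P * p))                 ≡⟨ factor u P n p ⟩
  P * (u * (7 * n + 6 * p))                           ∎
  where
  open ≡-Reasoning
  u P s : ℕ
  u = 8 ^ k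
  P = p ^ (2 * m + 1)
  s = 7 * a * d + a + d
  expand : ∀ u P n s → 7 * (u * P * n + 6 * s) + 6 ≡ 7 * (u * P * n) + 6 * (7 * s + 1)
  expand = solve-∀
  product : ∀ a d → (7 * a + 1) * (7 * d + 1) ≡ 7 * (7 * a * d + a + d) + 1
  product = solve-∀
  factor : ∀ u P n p → 7 * (u * P * n) + 6 * (u * (P * p)) ≡ P * (u * (7 * n + 6 * p))
  factor = solve-∀

p∤8^k[7n+6p] : ∀ {p} → Prime p → 8 ℕ.< p → ∀ k n → ¬ p ∣ℕ n → ¬ p ∣ℕ 8 ^ k * (7 * n + 6 * p)
p∤8^k[7n+6p] {p} p-prime 8<p k n p∤n p∣u with euclidsLemma (8 ^ k) (7 * n + 6 * p) p-prime p∣u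
... | inj₁ p∣8^k = ℕ.<⇒≱ 8<p (∣⇒≤ (prime∣^⇒∣ p-prime 8 k p∣8^k))
... | inj₂ p∣7n+6p with euclidsLemma 7 n p-prime (∣m+n∣m⇒∣n (subst (p ∣ℕ_) (ℕ.+-comm (7 * n) (6 * p)) p∣7n+6p) (divides 6 refl))
...   | inj₁ p∣7 = ℕ.<⇒≱ 8<p (ℕ.≤-trans (∣⇒≤ p∣7) (ℕ.n≤1+n 7))
...   | inj₂ p∣n = p∤n p∣n

¬sum-of-two-squares⇒E≡false : ∀ K → ¬ (∃ λ X → ∃ λ Y → X * X + Y * Y ≡ 7 * K + 6) → E K ≡ false
¬sum-of-two-squares⇒E≡false K ¬sq with E K in EK
... | false = refl
... | true  = ⊥-elim (¬sq (E≡true⇒sum-of-two-squares K EK))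

theorem6p2 : (p : ℕ) → Prime p → (p % 28 ≡ 15 ⊎ p % 28 ≡ 27) →
    (m n k : ℕ) → ¬ (p ∣ℕ n) →
    (+ 2) ∣ c 9 5 (2 ^ (3 * k + 3) * p ^ (2 * m + 1) * n
                   + (3 * 2 ^ (3 * k + 4) * p ^ (2 * m + 2) + 1) / 7)
theorem6p2 p p-prime p%28 m n k p∤n =
  let a , 8^k≡7a+1      = 7b+1^j≡7d+1 1 k
      b , p²≡7b+1       = p%28≡15∨27⇒p²≡1[7] p p%28
      d , p^[2m+2]≡7d+1 = p^[2m+2]≡1[7] p b m p²≡7b+1
      K                 = 8 ^ k * p ^ (2 * m + 1) * n + 6 * (7 * a * d + a + d)
  in subst (λ N → + 2 ∣ c 9 5 N) (sym (index≡8K+7 p m n k a d 8^k≡7a+1 p^[2m+2]≡7d+1))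
       (oddℤ≡false⇒2∣ (c 9 5 (8 * K + 7)) (begin
         C (8 * K + 7)   ≡⟨ C[8K+7]≡E K ⟩
         E K             ≡⟨ ¬sum-of-two-squares⇒E≡false K (λ (X , Y , X²+Y²≡7K+6) →
                              x²+y²≢p^odd*u p-prime p∣x²+y²⇒p∣x m X Y _ p∤u
                                (trans X²+Y²≡7K+6 (7K+6≡p^[2m+1]*u p m n k a d 8^k≡7a+1 p^[2m+2]≡7d+1))) ⟩
         false           ∎))
  where
  open ≡-Reasoning
  p∣x²+y²⇒p∣x : ∀ x y → p ∣ℕ x * x + y * y → p ∣ℕ x
  p∣x²+y²⇒p∣x = prime∣x²+y²⇒∣x p-prime (p%28≡15∨27⇒p%4≡3 p p%28)
  p∤u : ¬ p ∣ℕ 8 ^ k * (7 * n + 6 * p)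
  p∤u = p∤8^k[7n+6p] p-prime (p%28≡15∨27⇒8<p p p%28) k n p∤n
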